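{- The internal Hilbert series of $X_n$ is binomial: for every integer $j\ge0$, $$h_{n,- }(j)=\begin{cases}\binom{n-1}{j}, & 0\le j<n,\\ 0, & \text{otherwise.}\end{cases}$$
   Context: Let $(e_i)_{i=1}^n$ be the standard basis of $\mathbb{R}^n$, $e_0:=0$, $x_{2i-1}=e_i-e_{i-1}$, $x_{2i}=e_i$ ($i=1,\dots,n$), and $X_n=(x_1\prec\dots\prec x_{2n})$ ordered by index (the edges of the broken wheel graph $BW_n$; $x_1,x_2$ are distinct elements). A basis is an $n$-element subset $B\subseteq X_n$ forming a basis of $\mathbb{R}^n$. $\mathrm{val}(B)=|\{x\in X_n\setminus B:\{x\}\cup\{b\in B:b\prec x\}\text{ linearly independent}\}|$ and $\mathrm{val}^*(B)=|\{b\in B:(B\setminus\{b\})\cup\{x\in X_n\setminus B:b\prec x\}\text{ spans }\mathbb{R}^n\}|$. $B$ is internal if $\mathrm{val}^*(B)=n$, and $h_{n,- }(j)=|\{B \text{ internal}: \mathrm{val}(B)=j\}|$. -}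

module Defs where

open import Data.Nat using (ℕ; zero; suc; _*_; _∸_; _<_; _<?_; _/_; _%_; _≟_)
open import Data.Nat.Combinatorics using (_C_)
open import Data.Fin using (Fin; toℕ)
import Data.Fin as F
open import Data.Fin.Subset using (Subset; _∈_; _∉_; ∣_∣)
open import Data.Rational using (ℚ; 0ℚ; 1ℚ) renaming (_+_ to _+ℚ_; _-_ to _-ℚ_; _*_ to _*ℚ_)
open import Data.List using (List; length)
open import Data.List.Relation.Unary.Unique.Propositional using (Unique)
import Data.List.Membership.Propositional as LM
open import Data.Product using (Σ; _×_; ∃)
open import Data.Sum using (_⊎_)
open import Relation.Binary.PropositionalEquality using (_≡_)
open import Relation.Nullary using (yes; no; ¬_)
open import Function.Bundles using (_⇔_)

sumℚ : ∀ {m} → (Fin m → ℚ) → ℚ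
sumℚ {zero}  f = 0ℚ
sumℚ {suc m} f = f F.zero +ℚ sumℚ (λ i → f (F.suc i))

δ : ℕ → ℕ → ℚ
δ a b with a ≟ b
... | yes _ = 1ℚ
... | no  _ = 0ℚ

evenInd : ℕ → ℚ
evenInd t with t % 2 ≟ 0
... | yes _ = 1ℚ
... | no  _ = 0ℚ

-- The ground set X_n, 0-indexed: index t ∈ Fin (2n) is x_{t+1}.
-- With i = ⌊t/2⌋ (0-based coordinate):  t even ↦ e_i - e_{i-1} (e_{-1} = 0),
-- t odd ↦ e_i.
xvec : (n : ℕ) → Fin (2 * n) → Fin n → ℚ
xvec n t c = δ (toℕ c) (toℕ t / 2) -ℚ evenInd (toℕ t) *ℚ δ (suc (toℕ c)) (toℕ t / 2)

IdxSet : ℕ → Set₁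
IdxSet m = Fin m → Set

LinIndep : (n : ℕ) → IdxSet (2 * n) → Set
LinIndep n S =
  (c : Fin (2 * n) → ℚ) →
  (∀ t → ¬ S t → c t ≡ 0ℚ) →
  (∀ i → sumℚ (λ t → c t *ℚ xvec n t i) ≡ 0ℚ) →
  ∀ t → c t ≡ 0ℚ

Spans : (n : ℕ) → IdxSet (2 * n) → Set
Spans n S =
  (w : Fin n → ℚ) →
  Σ (Fin (2 * n) → ℚ) λ c →
    (∀ t → ¬ S t → c t ≡ 0ℚ) × (∀ i → sumℚ (λ t → c t *ℚ xvec n t i) ≡ w i)

CardIs : {A : Set} → (A → Set) → ℕ → Set
CardIs {A} P k = Σ (List A) λ xs → Unique xs × (∀ a → (a LM.∈ xs) ⇔ P a) × (length xs ≡ k)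

IsBasis : (n : ℕ) → Subset (2 * n) → Set
IsBasis n B = (∣ B ∣ ≡ n) × LinIndep n (_∈ B) × Spans n (_∈ B)

ValIs : (n : ℕ) → Subset (2 * n) → ℕ → Set
ValIs n B j =
  CardIs (λ x → (x ∉ B) × LinIndep n (λ t → (t ≡ x) ⊎ ((t ∈ B) × (toℕ t < toℕ x)))) j

ValStarIs : (n : ℕ) → Subset (2 * n) → ℕ → Set
ValStarIs n B j =
  CardIs (λ b → (b ∈ B) ×
    Spans n (λ t → ((t ∈ B) × ¬ (t ≡ b)) ⊎ ((t ∉ B) × (toℕ b < toℕ t)))) j

Internal : (n : ℕ) → Subset (2 * n) → Set
Internal n B = ValStarIs n B n

HIs : (n j k : ℕ) → Set
HIs n j k = CardIs (λ B → IsBasis n B × Internal n B × ValIs n B j) k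

binomRHS : ℕ → ℕ → ℕ
binomRHS n j with j <? n
... | yes _ = (n ∸ 1) C j
... | no  _ = 0

-- Index X_n by 0, …, 2n-1, so that x_{2i} = e_i - e_{i-1} and x_{2i+1} = e_i form the i-th pair.
-- A basis is internal exactly when it contains one element of every pair and not the last element
-- e_{n-1}. It cannot contain the last element, which has nothing above it and so is never internally
-- active; nor a whole pair {x_{2i}, x_{2i+1}}: truncating a representation of x_{2i} by elements of B
-- and larger external elements to the indices below 2i writes x_{2i} - x_{2i+1} with elements of B
-- below x_{2i}. Since |B| = n it then contains exactly one element of each pair. Conversely, for such a
-- basis B_s (s ⊆ {0, …, n-2} the pairs contributing e_i) every element is recovered by back
-- substitution from the top pair using the other elements and the larger external ones. The
-- externally active elements of B_s are the x_{2i} with i ∈ s, so val(B_s) = |s| and h_{n,-}(j)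
-- counts the j-element subsets of an (n-1)-element set.

module Submission where

open import Defs
open import Data.Bool using (Bool; true; false; not)
open import Data.Empty using (⊥; ⊥-elim)
open import Data.Fin as Fin using (Fin; toℕ; fromℕ<)
import Data.Fin.Properties as Finₚ
open import Data.Fin.Subset using (Subset; _∈_; _∉_; ∣_∣)
open import Data.List using (List; []; _∷_; length; map; _++_)
import Data.List.Properties as Listₚ
import Data.List.Membership.Propositional as Mem
import Data.List.Membership.Propositional.Properties as Memₚ
import Data.List.Relation.Unary.All as All
open import Data.List.Relation.Unary.AllPairs using ([]; _∷_)
open import Data.List.Relation.Unary.Any using (here; there)
open import Data.List.Relation.Unary.Unique.Propositional using (Unique)
import Data.List.Relation.Unary.Unique.Propositional.Properties as Uniqueₚ
open import Data.Nat as ℕ using (ℕ; zero; suc; _+_; _*_; _∸_; _<_; _≤_; z≤n; s≤s; _<?_; _≟_)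
import Data.Nat.Properties as ℕₚ
open import Data.Nat.Combinatorics using (_C_; nCk+nC[k+1]≡[n+1]C[k+1])
open import Data.Nat.Combinatorics.Specification using (k>n⇒nCk≡0)
open import Data.Nat.DivMod using (_/_; _%_; /-congˡ; %-congˡ; m*n/n≡m; m*n%n≡0; [m+kn]%n≡m%n; +-distrib-/)
open import Data.Product using (∃; _×_; _,_; proj₁; proj₂)
open import Data.Rational using (ℚ; 0ℚ; 1ℚ) renaming (_+_ to _+ℚ_; _-_ to _-ℚ_; _*_ to _*ℚ_; -_ to negℚ)
import Data.Rational.Properties as ℚₚ
open import Data.Rational.Solver using (module +-*-Solver)
open import Data.Sum as Sum using (_⊎_; inj₁; inj₂)
open import Data.Unit using (⊤; tt)
open import Data.Vec using ([]; _∷_; lookup; here; there)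
import Data.Vec.Properties as Vecₚ
open import Function.Base using (_∘_; const)
open import Function.Bundles using (_⇔_; mk⇔; Equivalence)
open import Relation.Binary.Definitions using (DecidableEquality)
open import Relation.Binary.PropositionalEquality
open import Relation.Nullary using (Dec; yes; no; ¬_)

open +-*-Solver using (solve; _:+_; _:*_; _:-_; _:=_; con)

2*[1+q]≡2+2*q : ∀ q → 2 * suc q ≡ suc (suc (2 * q))
2*[1+q]≡2+2*q q = ℕₚ.*-suc 2 q

parity : ∀ k → (∃ λ q → k ≡ 2 * q) ⊎ (∃ λ q → k ≡ suc (2 * q))
parity zero = inj₁ (0 , refl)
parity (suc zero) = inj₂ (0 , refl)
parity (suc (suc k)) with parity k
... | inj₁ (q , refl) = inj₁ (suc q , sym (2*[1+q]≡2+2*q q))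
... | inj₂ (q , refl) = inj₂ (suc q , cong suc (sym (2*[1+q]≡2+2*q q)))

[2*q]/2≡q : ∀ q → 2 * q / 2 ≡ q
[2*q]/2≡q q = trans (/-congˡ (ℕₚ.*-comm 2 q)) (m*n/n≡m q 2)

[2*q]%2≡0 : ∀ q → 2 * q % 2 ≡ 0
[2*q]%2≡0 q = trans (%-congˡ (ℕₚ.*-comm 2 q)) (m*n%n≡0 q 2)

[1+2*q]%2≡1 : ∀ q → suc (2 * q) % 2 ≡ 1
[1+2*q]%2≡1 q = trans (%-congˡ {o = 2} (cong suc (ℕₚ.*-comm 2 q))) ([m+kn]%n≡m%n 1 q 2)

[1+2*q]/2≡q : ∀ q → suc (2 * q) / 2 ≡ q
[1+2*q]/2≡q q = trans (+-distrib-/ 1 (2 * q) (subst (λ r → 1 + r < 2) (sym ([2*q]%2≡0 q)) ℕₚ.≤-refl)) ([2*q]/2≡q q)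

2*-injective : ∀ {a b} → 2 * a ≡ 2 * b → a ≡ b
2*-injective {a} {b} = ℕₚ.*-cancelˡ-≡ a b 2

1+2*-injective : ∀ {a b} → suc (2 * a) ≡ suc (2 * b) → a ≡ b
1+2*-injective = 2*-injective ∘ ℕₚ.suc-injective

2*-mono-< : ∀ {i n} → i < n → 2 * i < 2 * n
2*-mono-< = ℕₚ.*-monoʳ-< 2

1+2*-mono-< : ∀ {i n} → i < n → suc (2 * i) < 2 * n
1+2*-mono-< {i} i<n = ℕₚ.≤-trans (ℕₚ.≤-reflexive (sym (2*[1+q]≡2+2*q i))) (ℕₚ.*-monoʳ-≤ 2 i<n)

2*-cancel-< : ∀ {q n} → 2 * q < 2 * n → q < n
2*-cancel-< {q} {n} = ℕₚ.*-cancelˡ-< 2 q n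

1+2*-cancel-< : ∀ {q n} → suc (2 * q) < 2 * n → q < n
1+2*-cancel-< p = 2*-cancel-< (ℕₚ.<-trans (ℕₚ.n<1+n _) p)

m∸n≡1+[m∸1+n] : ∀ {m n} → n < m → m ∸ n ≡ suc (m ∸ suc n)
m∸n≡1+[m∸1+n] {suc m} {zero} _ = refl
m∸n≡1+[m∸1+n] {suc m} {suc n} (s≤s n<m) = m∸n≡1+[m∸1+n] n<m

δ-≡ : ∀ {a b} → a ≡ b → δ a b ≡ 1ℚ
δ-≡ {a} {b} a≡b with a ≟ b
... | yes _ = refl
... | no a≢b = ⊥-elim (a≢b a≡b)

δ-≢ : ∀ {a b} → ¬ a ≡ b → δ a b ≡ 0ℚ
δ-≢ {a} {b} a≢b with a ≟ b
... | yes a≡b = ⊥-elim (a≢b a≡b)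
... | no _ = refl

δ-cong : ∀ {a b c d} → (a ≡ b → c ≡ d) → (c ≡ d → a ≡ b) → δ a b ≡ δ c d
δ-cong {a} {b} to from with a ≟ b
... | yes a≡b = sym (δ-≡ (to a≡b))
... | no a≢b = sym (δ-≢ (a≢b ∘ from))

δ-sym : ∀ a b → δ a b ≡ δ b a
δ-sym a b = δ-cong {a} {b} {b} {a} sym sym

evenInd-2* : ∀ q → evenInd (2 * q) ≡ 1ℚ
evenInd-2* q with 2 * q % 2 ≟ 0
... | yes _ = refl
... | no r≢0 = ⊥-elim (r≢0 ([2*q]%2≡0 q))

evenInd-1+2* : ∀ q → evenInd (suc (2 * q)) ≡ 0ℚ
evenInd-1+2* q with suc (2 * q) % 2 ≟ 0
... | yes r≡0 = ⊥-elim (ℕₚ.1+n≢0 (trans (sym ([1+2*q]%2≡1 q)) r≡0))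
... | no _ = refl

-- Coordinate i of the combination Σₖ d k · x_k: only x_{2i}, x_{2i+1} (through e_i) and
-- x_{2i+2} = e_{i+1} - e_i contribute.
coord : (ℕ → ℚ) → ℕ → ℚ
coord d i = (d (2 * i) +ℚ d (suc (2 * i))) -ℚ d (2 * suc i)

xvecℕ : ℕ → ℕ → ℚ
xvecℕ k i = δ i (k / 2) -ℚ evenInd k *ℚ δ (suc i) (k / 2)

xvecℕ≡coord-δ : ∀ k i → xvecℕ k i ≡ coord (δ k) i
xvecℕ≡coord-δ k i with parity k
... | inj₁ (q , refl)
  rewrite [2*q]/2≡q q | evenInd-2* q
        | δ-cong {2 * q} {2 * i} {i} {q} (sym ∘ 2*-injective) (cong (2 *_) ∘ sym)
        | δ-≢ (ℕₚ.even≢odd q i)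
        | δ-cong {2 * q} {2 * suc i} {suc i} {q} (sym ∘ 2*-injective) (cong (2 *_) ∘ sym)
  = solve 2 (λ a b → a :- con 1ℚ :* b := (a :+ con 0ℚ) :- b) refl (δ i q) (δ (suc i) q)
... | inj₂ (q , refl)
  rewrite [1+2*q]/2≡q q | evenInd-1+2* q
        | δ-≢ {suc (2 * q)} {2 * i} (ℕₚ.even≢odd i q ∘ sym)
        | δ-cong {suc (2 * q)} {suc (2 * i)} {i} {q} (sym ∘ 1+2*-injective) (cong (suc ∘ (2 *_)) ∘ sym)
        | δ-≢ {suc (2 * q)} {2 * suc i} (ℕₚ.even≢odd (suc i) q ∘ sym)
  = solve 2 (λ a b → a :- con 0ℚ :* b := (con 0ℚ :+ a) :- con 0ℚ) refl (δ i q) (δ (suc i) q)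

xvecℕ-even : ∀ I j → xvecℕ (2 * I) j ≡ δ j I -ℚ δ (suc j) I
xvecℕ-even I j rewrite [2*q]/2≡q I | evenInd-2* I = cong (δ j I -ℚ_) (ℚₚ.*-identityˡ (δ (suc j) I))

xvecℕ-odd : ∀ I j → xvecℕ (suc (2 * I)) j ≡ δ j I
xvecℕ-odd I j rewrite [1+2*q]/2≡q I | evenInd-1+2* I =
  solve 2 (λ a b → a :- con 0ℚ :* b := a) refl (δ j I) (δ (suc j) I)

sumℕ : ℕ → (ℕ → ℚ) → ℚ
sumℕ zero f = 0ℚ
sumℕ (suc m) f = f 0 +ℚ sumℕ m (f ∘ suc)

sumℚ≡sumℕ : ∀ {m} (f : Fin m → ℚ) (g : ℕ → ℚ) → (∀ t → f t ≡ g (toℕ t)) → sumℚ f ≡ sumℕ m g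
sumℚ≡sumℕ {zero} f g f≗g = refl
sumℚ≡sumℕ {suc m} f g f≗g = cong₂ _+ℚ_ (f≗g Fin.zero) (sumℚ≡sumℕ (f ∘ Fin.suc) (g ∘ suc) (f≗g ∘ Fin.suc))

sumℕ-cong : ∀ m f g → (∀ k → k < m → f k ≡ g k) → sumℕ m f ≡ sumℕ m g
sumℕ-cong zero f g f≗g = refl
sumℕ-cong (suc m) f g f≗g = cong₂ _+ℚ_ (f≗g 0 (s≤s z≤n)) (sumℕ-cong m _ _ (λ k k<m → f≗g (suc k) (s≤s k<m)))

sumℕ-zero : ∀ m f → (∀ k → k < m → f k ≡ 0ℚ) → sumℕ m f ≡ 0ℚ
sumℕ-zero m f f≗0 = trans (sumℕ-cong m f (λ _ → 0ℚ) f≗0) (sumℕ-const-0 m)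
  where
  sumℕ-const-0 : ∀ m → sumℕ m (λ _ → 0ℚ) ≡ 0ℚ
  sumℕ-const-0 zero = refl
  sumℕ-const-0 (suc m) = cong (0ℚ +ℚ_) (sumℕ-const-0 m)

sumℕ-single : ∀ m f p → (∀ k → ¬ k ≡ p → f k ≡ 0ℚ) → p < m → sumℕ m f ≡ f p
sumℕ-single (suc m) f zero f≗0 _
  rewrite sumℕ-zero m (f ∘ suc) (λ k _ → f≗0 (suc k) λ ()) = ℚₚ.+-identityʳ (f 0)
sumℕ-single (suc m) f (suc p) f≗0 (s≤s p<m)
  rewrite f≗0 0 (λ ()) | sumℕ-single m (f ∘ suc) p (λ k k≢p → f≗0 (suc k) (k≢p ∘ ℕₚ.suc-injective)) p<m
  = ℚₚ.+-identityˡ (f (suc p))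

sumℕ-+ : ∀ m f g → sumℕ m (λ k → f k +ℚ g k) ≡ sumℕ m f +ℚ sumℕ m g
sumℕ-+ zero f g = refl
sumℕ-+ (suc m) f g rewrite sumℕ-+ m (f ∘ suc) (g ∘ suc) =
  solve 4 (λ a b c d → (a :+ b) :+ (c :+ d) := (a :+ c) :+ (b :+ d)) refl (f 0) (g 0) (sumℕ m (f ∘ suc)) (sumℕ m (g ∘ suc))

sumℕ-- : ∀ m f g → sumℕ m (λ k → f k -ℚ g k) ≡ sumℕ m f -ℚ sumℕ m g
sumℕ-- zero f g = refl
sumℕ-- (suc m) f g rewrite sumℕ-- m (f ∘ suc) (g ∘ suc) =
  solve 4 (λ a b c d → (a :- b) :+ (c :- d) := (a :+ c) :- (b :+ d)) refl (f 0) (g 0) (sumℕ m (f ∘ suc)) (sumℕ m (g ∘ suc))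

extend : ∀ {m} → (Fin m → ℚ) → ℕ → ℚ
extend {m} c k with k <? m
... | yes k<m = c (fromℕ< k<m)
... | no _ = 0ℚ

extend-toℕ : ∀ {m} (c : Fin m → ℚ) t → extend c (toℕ t) ≡ c t
extend-toℕ {m} c t with toℕ t <? m
... | yes t<m = cong c (Finₚ.fromℕ<-toℕ t t<m)
... | no t≮m = ⊥-elim (t≮m (Finₚ.toℕ<n t))

extend-fromℕ< : ∀ {m} (c : Fin m → ℚ) {k} (k<m : k < m) → extend c k ≡ c (fromℕ< k<m)
extend-fromℕ< c {k} k<m = trans (cong (extend c) (sym (Finₚ.toℕ-fromℕ< k<m))) (extend-toℕ c _)

extend-≥ : ∀ {m} (c : Fin m → ℚ) k → m ≤ k → extend c k ≡ 0ℚ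
extend-≥ {m} c k m≤k with k <? m
... | yes k<m = ⊥-elim (ℕₚ.<⇒≱ k<m m≤k)
... | no _ = refl

sumℕ-δ : ∀ m (d : ℕ → ℚ) p → (∀ k → m ≤ k → d k ≡ 0ℚ) → sumℕ m (λ k → d k *ℚ δ k p) ≡ d p
sumℕ-δ m d p d≥m≡0 with p <? m
... | yes p<m = begin
    sumℕ m (λ k → d k *ℚ δ k p)
  ≡⟨ sumℕ-single m _ p (λ k k≢p → trans (cong (d k *ℚ_) (δ-≢ k≢p)) (ℚₚ.*-zeroʳ (d k))) p<m ⟩
    d p *ℚ δ p p
  ≡⟨ trans (cong (d p *ℚ_) (δ-≡ {p} refl)) (ℚₚ.*-identityʳ (d p)) ⟩
    d p ∎
  where open ≡-Reasoning
... | no p≮m = begin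
    sumℕ m (λ k → d k *ℚ δ k p)
  ≡⟨ sumℕ-zero m _ (λ k k<m → trans (cong (d k *ℚ_) (δ-≢ {k} {p} λ { refl → p≮m k<m })) (ℚₚ.*-zeroʳ (d k))) ⟩
    0ℚ
  ≡⟨ sym (d≥m≡0 p (ℕₚ.≮⇒≥ p≮m)) ⟩
    d p ∎
  where open ≡-Reasoning

sumℚ-xvec≡coord : ∀ n (c : Fin (2 * n) → ℚ) (i : Fin n) →
  sumℚ (λ t → c t *ℚ xvec n t i) ≡ coord (extend c) (toℕ i)
sumℚ-xvec≡coord n c i = begin
    sumℚ (λ t → c t *ℚ xvec n t i)
  ≡⟨ sumℚ≡sumℕ _ (λ k → d k *ℚ xvecℕ k j) (λ t → cong (_*ℚ xvec n t i) (sym (extend-toℕ c t))) ⟩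
    sumℕ M (λ k → d k *ℚ xvecℕ k j)
  ≡⟨ sumℕ-cong M _ _ (λ k _ → trans (cong (d k *ℚ_) (xvecℕ≡coord-δ k j)) (distrib (d k) (δ k a) (δ k b) (δ k e))) ⟩
    sumℕ M (λ k → (d k *ℚ δ k a +ℚ d k *ℚ δ k b) -ℚ d k *ℚ δ k e)
  ≡⟨ trans (sumℕ-- M _ _) (cong (_-ℚ sumℕ M (λ k → d k *ℚ δ k e)) (sumℕ-+ M _ _)) ⟩
    (sumℕ M (λ k → d k *ℚ δ k a) +ℚ sumℕ M (λ k → d k *ℚ δ k b)) -ℚ sumℕ M (λ k → d k *ℚ δ k e)
  ≡⟨ cong₂ _-ℚ_ (cong₂ _+ℚ_ (sumℕ-δ M d a d≥M≡0) (sumℕ-δ M d b d≥M≡0)) (sumℕ-δ M d e d≥M≡0) ⟩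
    coord d j ∎
  where
  open ≡-Reasoning
  M = 2 * n
  d = extend c
  j = toℕ i
  a = 2 * j
  b = suc (2 * j)
  e = 2 * suc j
  d≥M≡0 : ∀ k → M ≤ k → d k ≡ 0ℚ
  d≥M≡0 = extend-≥ c
  distrib : ∀ x a b e → x *ℚ ((a +ℚ b) -ℚ e) ≡ (x *ℚ a +ℚ x *ℚ b) -ℚ x *ℚ e
  distrib = solve 4 (λ x a b e → x :* ((a :+ b) :- e) := (x :* a :+ x :* b) :- x :* e) refl

coord-extend : ∀ n (c : Fin (2 * n) → ℚ) (w : Fin n → ℚ) →
  (∀ i → sumℚ (λ t → c t *ℚ xvec n t i) ≡ w i) → ∀ i → i < n → coord (extend c) i ≡ extend w i
coord-extend n c w c↦w i i<n = begin
  coord (extend c) i                   ≡⟨ cong (coord (extend c)) (sym (Finₚ.toℕ-fromℕ< i<n)) ⟩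
  coord (extend c) (toℕ (fromℕ< i<n))  ≡⟨ sym (sumℚ-xvec≡coord n c (fromℕ< i<n)) ⟩
  sumℚ (λ t → c t *ℚ xvec n t (fromℕ< i<n)) ≡⟨ c↦w (fromℕ< i<n) ⟩
  w (fromℕ< i<n)                       ≡⟨ sym (extend-fromℕ< w i<n) ⟩
  extend w i                           ∎
  where open ≡-Reasoning

Avoids : ∀ {m} → (Fin m → Set) → ℕ → Set
Avoids {m} S k = ∀ (t : Fin m) → toℕ t ≡ k → ¬ S t

extend-avoided : ∀ {m} (S : Fin m → Set) (c : Fin m → ℚ) → (∀ t → ¬ S t → c t ≡ 0ℚ) →
  ∀ k → Avoids S k → extend c k ≡ 0ℚ
extend-avoided {m} S c c⊆S k avoids with k <? m
... | yes k<m = c⊆S _ (avoids _ (Finₚ.toℕ-fromℕ< k<m))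
... | no _ = refl

-- Back substitution from the top pair, where d (2 n) = 0.
coord-kernel : ∀ n (d : ℕ → ℚ) → (∀ k → 2 * n ≤ k → d k ≡ 0ℚ) → (∀ i → i < n → coord d i ≡ 0ℚ) →
  (∀ i → i < n → d (2 * i) ≡ 0ℚ ⊎ d (suc (2 * i)) ≡ 0ℚ) → ∀ k → d k ≡ 0ℚ
coord-kernel n d d≥2n≡0 coord≡0 pair-zero = d≡0
  where
  other-zero : ∀ {a b c} → (a +ℚ b) -ℚ c ≡ 0ℚ → c ≡ 0ℚ → b ≡ 0ℚ → a ≡ 0ℚ
  other-zero {a} {b} {c} eq refl refl = trans (solve 1 (λ a → a := (a :+ con 0ℚ) :- con 0ℚ) refl a) eq

  even-zero-from : ∀ r i → i + r ≡ n → d (2 * i) ≡ 0ℚ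
  even-zero-from zero i refl = d≥2n≡0 _ (ℕₚ.≤-reflexive (cong (2 *_) (ℕₚ.+-identityʳ i)))
  even-zero-from (suc r) i i+1+r≡n = from-pair (pair-zero i i<n)
    where
    i<n = ℕₚ.≤-trans (ℕₚ.m<m+n i (s≤s z≤n)) (ℕₚ.≤-reflexive i+1+r≡n)
    from-pair : d (2 * i) ≡ 0ℚ ⊎ d (suc (2 * i)) ≡ 0ℚ → d (2 * i) ≡ 0ℚ
    from-pair (inj₁ d₂ᵢ≡0) = d₂ᵢ≡0
    from-pair (inj₂ d₂ᵢ₊₁≡0) =
      other-zero (coord≡0 i i<n) (even-zero-from r (suc i) (trans (sym (ℕₚ.+-suc i r)) i+1+r≡n)) d₂ᵢ₊₁≡0

  even-zero : ∀ i → i ≤ n → d (2 * i) ≡ 0ℚ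
  even-zero i i≤n = even-zero-from (n ∸ i) i (ℕₚ.m+[n∸m]≡n i≤n)

  odd-zero : ∀ i → i < n → d (suc (2 * i)) ≡ 0ℚ
  odd-zero i i<n = other-zero (trans (cong (_-ℚ d (2 * suc i)) (ℚₚ.+-comm (d (suc (2 * i))) (d (2 * i)))) (coord≡0 i i<n))
                              (even-zero (suc i) i<n) (even-zero i (ℕₚ.<⇒≤ i<n))

  d≡0 : ∀ k → d k ≡ 0ℚ
  d≡0 k with parity k
  ... | inj₁ (q , refl) with q ℕ.≤? n
  ...   | yes q≤n = even-zero q q≤n
  ...   | no q≰n = d≥2n≡0 _ (ℕₚ.*-monoʳ-≤ 2 (ℕₚ.<⇒≤ (ℕₚ.≰⇒> q≰n)))
  d≡0 k | inj₂ (q , refl) with q <? n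
  ...   | yes q<n = odd-zero q q<n
  ...   | no q≮n = d≥2n≡0 _ (ℕₚ.≤-trans (ℕₚ.*-monoʳ-≤ 2 (ℕₚ.≮⇒≥ q≮n)) (ℕₚ.n≤1+n _))

linIndep-if-pairs-avoided : ∀ n (S : Fin (2 * n) → Set) →
  (∀ i → i < n → Avoids S (2 * i) ⊎ Avoids S (suc (2 * i))) → LinIndep n S
linIndep-if-pairs-avoided n S avoided c c⊆S c↦0 t =
  trans (sym (extend-toℕ c t))
        (coord-kernel n (extend c) (extend-≥ c)
          (λ i i<n → trans (coord-extend n c (λ _ → 0ℚ) c↦0 i i<n) (extend-0 i))
          (λ i i<n → Sum.map (extend-avoided S c c⊆S _) (extend-avoided S c c⊆S _) (avoided i i<n))
          (toℕ t))
  where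
  extend-0 : ∀ k → extend {n} (λ _ → 0ℚ) k ≡ 0ℚ
  extend-0 k with k <? n
  ... | yes _ = refl
  ... | no _ = refl

-- How the amount a pair has to contribute is split between its two elements.
data Share : Set where
  evenOnly oddOnly neither : Share
  both : ℚ → Share

evenPart : Share → ℚ → ℚ
evenPart evenOnly T = T
evenPart oddOnly _ = 0ℚ
evenPart neither _ = 0ℚ
evenPart (both v) _ = v

oddPart : Share → ℚ → ℚ
oddPart evenOnly _ = 0ℚ
oddPart oddOnly T = T
oddPart neither _ = 0ℚ
oddPart (both v) T = T -ℚ v

UsesEven : Share → Set
UsesEven evenOnly = ⊤
UsesEven oddOnly = ⊥
UsesEven neither = ⊥
UsesEven (both _) = ⊤

UsesOdd : Share → Set
UsesOdd evenOnly = ⊥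
UsesOdd oddOnly = ⊤
UsesOdd neither = ⊥
UsesOdd (both _) = ⊤

UsesEven⊎evenPart≡0 : ∀ s T → UsesEven s ⊎ evenPart s T ≡ 0ℚ
UsesEven⊎evenPart≡0 evenOnly _ = inj₁ tt
UsesEven⊎evenPart≡0 oddOnly _ = inj₂ refl
UsesEven⊎evenPart≡0 neither _ = inj₂ refl
UsesEven⊎evenPart≡0 (both _) _ = inj₁ tt

UsesOdd⊎oddPart≡0 : ∀ s T → UsesOdd s ⊎ oddPart s T ≡ 0ℚ
UsesOdd⊎oddPart≡0 evenOnly _ = inj₂ refl
UsesOdd⊎oddPart≡0 oddOnly _ = inj₁ tt
UsesOdd⊎oddPart≡0 neither _ = inj₂ refl
UsesOdd⊎oddPart≡0 (both _) _ = inj₁ tt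

parts-sum : ∀ s T → (s ≡ neither × evenPart s T +ℚ oddPart s T ≡ 0ℚ) ⊎ evenPart s T +ℚ oddPart s T ≡ T
parts-sum evenOnly T = inj₂ (ℚₚ.+-identityʳ T)
parts-sum oddOnly T = inj₂ (ℚₚ.+-identityˡ T)
parts-sum neither T = inj₁ (refl , refl)
parts-sum (both v) T = inj₂ (solve 2 (λ v T → v :+ (T :- v) := T) refl v T)

-- Solving coord c i = w i for i < n from the top pair down: pair i must contribute
-- w i plus the coefficient of x_{2i+2}, which pair i+1 has already fixed.
module BackSubstitution (n : ℕ) (w : ℕ → ℚ) (share : ℕ → Share) where

  totalWithin : ℕ → ℕ → ℚ
  totalWithin i zero = 0ℚ
  totalWithin i (suc zero) = w i
  totalWithin i (suc (suc r)) = w i +ℚ evenPart (share (suc i)) (totalWithin (suc i) (suc r))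

  pairTotal : ℕ → ℚ
  pairTotal i = totalWithin i (n ∸ i)

  coeffOf : ℕ → ℕ → ℚ
  coeffOf zero i = evenPart (share i) (pairTotal i)
  coeffOf (suc _) i = oddPart (share i) (pairTotal i)

  coeff : ℕ → ℚ
  coeff k = coeffOf (k % 2) (k / 2)

  coeff-even : ∀ i → coeff (2 * i) ≡ evenPart (share i) (pairTotal i)
  coeff-even i = cong₂ coeffOf ([2*q]%2≡0 i) ([2*q]/2≡q i)

  coeff-odd : ∀ i → coeff (suc (2 * i)) ≡ oddPart (share i) (pairTotal i)
  coeff-odd i = cong₂ coeffOf ([1+2*q]%2≡1 i) ([1+2*q]/2≡q i)

  pairTotal-step : ∀ i → suc i < n → pairTotal i ≡ w i +ℚ coeff (2 * suc i)
  pairTotal-step i i+1<n = begin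
      totalWithin i (n ∸ i)
    ≡⟨ cong (totalWithin i) (trans (m∸n≡1+[m∸1+n] i<n) (cong suc (m∸n≡1+[m∸1+n] i+1<n))) ⟩
      w i +ℚ evenPart (share (suc i)) (totalWithin (suc i) (suc (n ∸ suc (suc i))))
    ≡⟨ cong (λ r → w i +ℚ evenPart (share (suc i)) (totalWithin (suc i) r)) (sym (m∸n≡1+[m∸1+n] i+1<n)) ⟩
      w i +ℚ evenPart (share (suc i)) (pairTotal (suc i))
    ≡⟨ cong (w i +ℚ_) (sym (coeff-even (suc i))) ⟩
      w i +ℚ coeff (2 * suc i) ∎
    where
    open ≡-Reasoning
    i<n = ℕₚ.<-trans (ℕₚ.n<1+n i) i+1<n

  pairTotal-top : ∀ i → suc i ≡ n → pairTotal i ≡ w i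
  pairTotal-top i refl = cong (totalWithin i) (ℕₚ.m+n∸n≡m 1 i)

  coord-coeff : (d : ℕ → ℚ) → (∀ k → k < 2 * n → d k ≡ coeff k) → (∀ k → 2 * n ≤ k → d k ≡ 0ℚ) →
    (∀ i → i < n → share i ≡ neither → pairTotal i ≡ 0ℚ) → ∀ i → i < n → coord d i ≡ w i
  coord-coeff d d≡coeff d≥2n≡0 balanced i i<n = by-parts (parts-sum (share i) (pairTotal i))
    where
    open ≡-Reasoning
    next = d (2 * suc i)

    pair≡parts : d (2 * i) +ℚ d (suc (2 * i)) ≡ evenPart (share i) (pairTotal i) +ℚ oddPart (share i) (pairTotal i)
    pair≡parts = cong₂ _+ℚ_ (trans (d≡coeff _ (2*-mono-< i<n)) (coeff-even i))
                            (trans (d≡coeff _ (1+2*-mono-< i<n)) (coeff-odd i))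

    total≡w+next : pairTotal i ≡ w i +ℚ next
    total≡w+next with suc i <? n
    ... | yes i+1<n = trans (pairTotal-step i i+1<n) (cong (w i +ℚ_) (sym (d≡coeff _ (2*-mono-< i+1<n))))
    ... | no i+1≮n = trans (pairTotal-top i (ℕₚ.≤-antisym i<n (ℕₚ.≮⇒≥ i+1≮n)))
        (trans (sym (ℚₚ.+-identityʳ (w i))) (cong (w i +ℚ_) (sym (d≥2n≡0 _ (ℕₚ.*-monoʳ-≤ 2 (ℕₚ.≮⇒≥ i+1≮n))))))

    by-parts : (share i ≡ neither × evenPart (share i) (pairTotal i) +ℚ oddPart (share i) (pairTotal i) ≡ 0ℚ)
             ⊎ evenPart (share i) (pairTotal i) +ℚ oddPart (share i) (pairTotal i) ≡ pairTotal i →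
             coord d i ≡ w i
    by-parts (inj₁ (share≡neither , parts≡0)) = begin
      coord d i                  ≡⟨ cong (_-ℚ next) (trans pair≡parts parts≡0) ⟩
      0ℚ -ℚ next                 ≡⟨ cong (0ℚ -ℚ_) (solve 2 (λ w y → y := (w :+ y) :- w) refl (w i) next) ⟩
      0ℚ -ℚ ((w i +ℚ next) -ℚ w i) ≡⟨ cong (λ y → 0ℚ -ℚ (y -ℚ w i)) (trans (sym total≡w+next) (balanced i i<n share≡neither)) ⟩
      0ℚ -ℚ (0ℚ -ℚ w i)          ≡⟨ solve 1 (λ w → con 0ℚ :- (con 0ℚ :- w) := w) refl (w i) ⟩
      w i                        ∎
    by-parts (inj₂ parts≡total) = begin
      coord d i                  ≡⟨ cong (_-ℚ next) (trans pair≡parts (trans parts≡total total≡w+next)) ⟩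
      (w i +ℚ next) -ℚ next      ≡⟨ solve 2 (λ w y → (w :+ y) :- y := w) refl (w i) next ⟩
      w i                        ∎

record Schedule (n : ℕ) (S : Fin (2 * n) → Set) (w : ℕ → ℚ) : Set where
  field
    share : ℕ → Share
    balanced : ∀ i → i < n → share i ≡ neither → BackSubstitution.pairTotal n w share i ≡ 0ℚ
    even∈S : ∀ i → i < n → UsesEven (share i) → ∀ t → toℕ t ≡ 2 * i → S t
    odd∈S : ∀ i → i < n → UsesOdd (share i) → ∀ t → toℕ t ≡ suc (2 * i) → S t

  open BackSubstitution n w share public

  coeffs : Fin (2 * n) → ℚ
  coeffs t = coeff (toℕ t)

  coeffs-supported : ∀ t → ¬ S t → coeffs t ≡ 0ℚ
  coeffs-supported t t∉S with parity (toℕ t)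
  ... | inj₁ (i , t≡2i) with UsesEven⊎evenPart≡0 (share i) (pairTotal i)
  ...   | inj₁ uses = ⊥-elim (t∉S (even∈S i (2*-cancel-< (subst (_< 2 * n) t≡2i (Finₚ.toℕ<n t))) uses t t≡2i))
  ...   | inj₂ part≡0 = trans (cong coeff t≡2i) (trans (coeff-even i) part≡0)
  coeffs-supported t t∉S | inj₂ (i , t≡2i+1) with UsesOdd⊎oddPart≡0 (share i) (pairTotal i)
  ...   | inj₁ uses = ⊥-elim (t∉S (odd∈S i (1+2*-cancel-< (subst (_< 2 * n) t≡2i+1 (Finₚ.toℕ<n t))) uses t t≡2i+1))
  ...   | inj₂ part≡0 = trans (cong coeff t≡2i+1) (trans (coeff-odd i) part≡0)

  coeffs-combination : ∀ i → sumℚ (λ t → coeffs t *ℚ xvec n t i) ≡ w (toℕ i)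
  coeffs-combination i = trans (sumℚ-xvec≡coord n coeffs i)
    (coord-coeff (extend coeffs) extend-coeffs (extend-≥ coeffs) balanced (toℕ i) (Finₚ.toℕ<n i))
    where
    extend-coeffs : ∀ k → k < 2 * n → extend coeffs k ≡ coeff k
    extend-coeffs k k<2n = trans (extend-fromℕ< coeffs k<2n) (cong coeff (Finₚ.toℕ-fromℕ< k<2n))

spans-by-schedules : ∀ n (S : Fin (2 * n) → Set) → (∀ (w : Fin n → ℚ) → Schedule n S (extend w)) → Spans n S
spans-by-schedules n S schedule w =
  coeffs , coeffs-supported , λ i → trans (coeffs-combination i) (extend-toℕ w i)
  where open Schedule (schedule w)

-1≢0 : ¬ negℚ 1ℚ ≡ 0ℚ
-1≢0 ()

sumℚ-cong : ∀ {m} {f g : Fin m → ℚ} → (∀ t → f t ≡ g t) → sumℚ f ≡ sumℚ g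
sumℚ-cong {zero} f≗g = refl
sumℚ-cong {suc m} f≗g = cong₂ _+ℚ_ (f≗g Fin.zero) (sumℚ-cong (f≗g ∘ Fin.suc))

sumℚ-- : ∀ {m} (f g : Fin m → ℚ) → sumℚ (λ t → f t -ℚ g t) ≡ sumℚ f -ℚ sumℚ g
sumℚ-- {zero} f g = refl
sumℚ-- {suc m} f g rewrite sumℚ-- (f ∘ Fin.suc) (g ∘ Fin.suc) =
  solve 4 (λ a b c d → (a :- b) :+ (c :- d) := (a :+ c) :- (b :+ d)) refl
    (f Fin.zero) (g Fin.zero) (sumℚ (f ∘ Fin.suc)) (sumℚ (g ∘ Fin.suc))

sumℚ-δ-xvec : ∀ n (b : Fin (2 * n)) i → sumℚ (λ t → δ (toℕ t) (toℕ b) *ℚ xvec n t i) ≡ xvec n b i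
sumℚ-δ-xvec n b i = begin
    sumℚ (λ t → δ (toℕ t) (toℕ b) *ℚ xvec n t i)
  ≡⟨ sumℚ≡sumℕ _ (λ k → xvecℕ k (toℕ i) *ℚ δ k (toℕ b)) (λ t → ℚₚ.*-comm (δ (toℕ t) (toℕ b)) (xvec n t i)) ⟩
    sumℕ (2 * n) (λ k → xvecℕ k (toℕ i) *ℚ δ k (toℕ b))
  ≡⟨ sumℕ-single (2 * n) _ (toℕ b) (λ k k≢b → trans (cong (xvecℕ k (toℕ i) *ℚ_) (δ-≢ k≢b)) (ℚₚ.*-zeroʳ (xvecℕ k (toℕ i)))) (Finₚ.toℕ<n b) ⟩
    xvec n b i *ℚ δ (toℕ b) (toℕ b)
  ≡⟨ trans (cong (xvec n b i *ℚ_) (δ-≡ {toℕ b} refl)) (ℚₚ.*-identityʳ (xvec n b i)) ⟩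
    xvec n b i ∎
  where open ≡-Reasoning

combination⇒¬linIndep : ∀ n (S T : Fin (2 * n) → Set) (b : Fin (2 * n)) → S b → ¬ T b → (∀ t → T t → S t) →
  (c : Fin (2 * n) → ℚ) → (∀ t → ¬ T t → c t ≡ 0ℚ) →
  (∀ i → sumℚ (λ t → c t *ℚ xvec n t i) ≡ xvec n b i) → ¬ LinIndep n S
combination⇒¬linIndep n S T b b∈S b∉T T⊆S c c⊆T c↦xb indep = -1≢0 (trans (sym d[b]≡-1) (indep d d⊆S d↦0 b))
  where
  d : Fin (2 * n) → ℚ
  d t = c t -ℚ δ (toℕ t) (toℕ b)
  d⊆S : ∀ t → ¬ S t → d t ≡ 0ℚ
  d⊆S t t∉S rewrite c⊆T t (t∉S ∘ T⊆S t) | δ-≢ {toℕ t} {toℕ b} (λ t≡b → t∉S (subst S (sym (Finₚ.toℕ-injective t≡b)) b∈S)) = refl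
  d↦0 : ∀ i → sumℚ (λ t → d t *ℚ xvec n t i) ≡ 0ℚ
  d↦0 i = begin
      sumℚ (λ t → d t *ℚ xvec n t i)
    ≡⟨ sumℚ-cong (λ t → solve 3 (λ c e x → (c :- e) :* x := c :* x :- e :* x) refl (c t) (δ (toℕ t) (toℕ b)) (xvec n t i)) ⟩
      sumℚ (λ t → c t *ℚ xvec n t i -ℚ δ (toℕ t) (toℕ b) *ℚ xvec n t i)
    ≡⟨ sumℚ-- (λ t → c t *ℚ xvec n t i) (λ t → δ (toℕ t) (toℕ b) *ℚ xvec n t i) ⟩
      sumℚ (λ t → c t *ℚ xvec n t i) -ℚ sumℚ (λ t → δ (toℕ t) (toℕ b) *ℚ xvec n t i)
    ≡⟨ cong₂ _-ℚ_ (c↦xb i) (sumℚ-δ-xvec n b i) ⟩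
      xvec n b i -ℚ xvec n b i
    ≡⟨ ℚₚ.+-inverseʳ (xvec n b i) ⟩
      0ℚ ∎
    where open ≡-Reasoning
  d[b]≡-1 : d b ≡ negℚ 1ℚ
  d[b]≡-1 rewrite c⊆T b b∉T | δ-≡ {toℕ b} refl = refl

extend-tabulate : ∀ {m} (g : ℕ → ℚ) → (∀ k → m ≤ k → g k ≡ 0ℚ) → ∀ k → extend {m} (g ∘ toℕ) k ≡ g k
extend-tabulate {m} g g≥m≡0 k with k <? m
... | yes k<m = cong g (Finₚ.toℕ-fromℕ< k<m)
... | no k≮m = sym (g≥m≡0 k (ℕₚ.≮⇒≥ k≮m))

coord-+ : ∀ f g i → coord (λ k → f k +ℚ g k) i ≡ coord f i +ℚ coord g i
coord-+ f g i = solve 6 (λ a b c a′ b′ c′ → ((a :+ a′) :+ (b :+ b′)) :- (c :+ c′) := ((a :+ b) :- c) :+ ((a′ :+ b′) :- c′)) refl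
  (f (2 * i)) (f (suc (2 * i))) (f (2 * suc i)) (g (2 * i)) (g (suc (2 * i))) (g (2 * suc i))

coord-δ : ∀ p i → coord (λ k → δ k p) i ≡ xvecℕ p i
coord-δ p i = trans (cong₂ _-ℚ_ (cong₂ _+ℚ_ (δ-sym (2 * i) p) (δ-sym (suc (2 * i)) p)) (δ-sym (2 * suc i) p)) (sym (xvecℕ≡coord-δ p i))

cut : ℕ → (ℕ → ℚ) → ℕ → ℚ
cut L d k with k <? L
... | yes _ = d k
... | no _ = 0ℚ

cut-≤ : ∀ L d k → d L ≡ 0ℚ → k ≤ L → cut L d k ≡ d k
cut-≤ L d k dL≡0 k≤L with k <? L
... | yes _ = refl
... | no k≮L = sym (trans (cong d (ℕₚ.≤-antisym k≤L (ℕₚ.≮⇒≥ k≮L))) dL≡0)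

cut-≥ : ∀ L d k → L ≤ k → cut L d k ≡ 0ℚ
cut-≥ L d k L≤k with k <? L
... | yes k<L = ⊥-elim (ℕₚ.<⇒≱ k<L L≤k)
... | no _ = refl

coord-cut-below : ∀ I d j → d (2 * I) ≡ 0ℚ → j < I → coord (cut (2 * I) d) j ≡ coord d j
coord-cut-below I d j d₂ᵢ≡0 j<I = cong₂ _-ℚ_
  (cong₂ _+ℚ_ (cut-≤ _ d _ d₂ᵢ≡0 (ℕₚ.<⇒≤ (2*-mono-< j<I))) (cut-≤ _ d _ d₂ᵢ≡0 (ℕₚ.<⇒≤ (1+2*-mono-< j<I))))
  (cut-≤ _ d _ d₂ᵢ≡0 (ℕₚ.*-monoʳ-≤ 2 j<I))

coord-cut-above : ∀ I d j → I ≤ j → coord (cut (2 * I) d) j ≡ 0ℚ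
coord-cut-above I d j I≤j
  rewrite cut-≥ (2 * I) d (2 * j) (ℕₚ.*-monoʳ-≤ 2 I≤j)
        | cut-≥ (2 * I) d (suc (2 * j)) (ℕₚ.m≤n⇒m≤1+n (ℕₚ.*-monoʳ-≤ 2 I≤j))
        | cut-≥ (2 * I) d (2 * suc j) (ℕₚ.*-monoʳ-≤ 2 (ℕₚ.m≤n⇒m≤1+n I≤j)) = refl

-- Below coordinate I, x_{2I+1} = e_I contributes nothing and the truncation changes nothing (d (2I) = 0);
-- from coordinate I on, the truncation vanishes and x_{2I} agrees with e_I.
coord-truncate-pair : ∀ I d j → d (2 * I) ≡ 0ℚ → (j < I → coord d j ≡ xvecℕ (2 * I) j) →
  coord (λ k → cut (2 * I) d k +ℚ δ k (suc (2 * I))) j ≡ xvecℕ (2 * I) j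
coord-truncate-pair I d j d[2I]≡0 coord-below with j <? I
... | yes j<I = begin
  coord (λ k → cut (2 * I) d k +ℚ δ k (suc (2 * I))) j
                                    ≡⟨ coord-+ (cut (2 * I) d) (λ k → δ k (suc (2 * I))) j ⟩
  coord (cut (2 * I) d) j +ℚ coord (λ k → δ k (suc (2 * I))) j
                                    ≡⟨ cong₂ _+ℚ_ (coord-cut-below I d j d[2I]≡0 j<I) (trans (coord-δ (suc (2 * I)) j) (xvecℕ-odd I j)) ⟩
  coord d j +ℚ δ j I                ≡⟨ cong₂ _+ℚ_ (coord-below j<I) (δ-≢ (ℕₚ.<⇒≢ j<I)) ⟩
  xvecℕ (2 * I) j +ℚ 0ℚ             ≡⟨ ℚₚ.+-identityʳ (xvecℕ (2 * I) j) ⟩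
  xvecℕ (2 * I) j                   ∎
  where open ≡-Reasoning
... | no j≮I = begin
  coord (λ k → cut (2 * I) d k +ℚ δ k (suc (2 * I))) j
                                    ≡⟨ coord-+ (cut (2 * I) d) (λ k → δ k (suc (2 * I))) j ⟩
  coord (cut (2 * I) d) j +ℚ coord (λ k → δ k (suc (2 * I))) j
                                    ≡⟨ cong₂ _+ℚ_ (coord-cut-above I d j (ℕₚ.≮⇒≥ j≮I)) (trans (coord-δ (suc (2 * I)) j) (xvecℕ-odd I j)) ⟩
  0ℚ +ℚ δ j I                       ≡⟨ solve 1 (λ x → con 0ℚ :+ x := x :- con 0ℚ) refl (δ j I) ⟩
  δ j I -ℚ 0ℚ                       ≡⟨ cong (δ j I -ℚ_) (sym (δ-≢ (ℕₚ.<⇒≢ (s≤s (ℕₚ.≮⇒≥ j≮I)) ∘ sym))) ⟩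
  δ j I -ℚ δ (suc j) I              ≡⟨ sym (xvecℕ-even I j) ⟩
  xvecℕ (2 * I) j                   ∎
  where open ≡-Reasoning

coord-cong : ∀ f g → (∀ k → f k ≡ g k) → ∀ i → coord f i ≡ coord g i
coord-cong f g f≗g i = cong₂ _-ℚ_ (cong₂ _+ℚ_ (f≗g _) (f≗g _)) (f≗g _)


bit : ∀ {m} → Subset m → ℕ → Bool
bit [] k = false
bit (b ∷ B) zero = b
bit (b ∷ B) (suc k) = bit B k

lookup≡bit : ∀ {m} (B : Subset m) t → lookup B t ≡ bit B (toℕ t)
lookup≡bit (b ∷ B) Fin.zero = refl
lookup≡bit (b ∷ B) (Fin.suc t) = lookup≡bit B t

∈⇒bit≡true : ∀ {m} {B : Subset m} {t} → t ∈ B → bit B (toℕ t) ≡ true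
∈⇒bit≡true {B = B} {t} t∈B = trans (sym (lookup≡bit B t)) (Vecₚ.[]=⇒lookup t∈B)

bit≡true⇒∈ : ∀ {m} {B : Subset m} {t k} → toℕ t ≡ k → bit B k ≡ true → t ∈ B
bit≡true⇒∈ {B = B} {t} refl bit≡true = Vecₚ.lookup⇒[]= t B (trans (lookup≡bit B t) bit≡true)

bit≡false⇒∉ : ∀ {m} {B : Subset m} {t k} → toℕ t ≡ k → bit B k ≡ false → t ∉ B
bit≡false⇒∉ refl bit≡false t∈B with trans (sym bit≡false) (∈⇒bit≡true t∈B)
... | ()

∉⇒bit≡false : ∀ {m} {B : Subset m} {t} → t ∉ B → bit B (toℕ t) ≡ false
∉⇒bit≡false {B = B} {t} t∉B with bit B (toℕ t) in eq
... | true = ⊥-elim (t∉B (bit≡true⇒∈ refl eq))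
... | false = refl

bit-≥ : ∀ {m} (B : Subset m) k → m ≤ k → bit B k ≡ false
bit-≥ [] k _ = refl
bit-≥ (b ∷ B) (suc k) (s≤s m≤k) = bit-≥ B k m≤k

fromBits : (k : ℕ) → (ℕ → Bool) → Subset k
fromBits zero f = []
fromBits (suc k) f = f 0 ∷ fromBits k (f ∘ suc)

bit-fromBits : ∀ k f j → j < k → bit (fromBits k f) j ≡ f j
bit-fromBits (suc k) f zero _ = refl
bit-fromBits (suc k) f (suc j) (s≤s j<k) = bit-fromBits k (f ∘ suc) j j<k

bit-extensionality : ∀ {m} (A B : Subset m) → (∀ j → j < m → bit A j ≡ bit B j) → A ≡ B
bit-extensionality [] [] _ = refl
bit-extensionality (a ∷ A) (b ∷ B) A≗B =
  cong₂ _∷_ (A≗B 0 (s≤s z≤n)) (bit-extensionality A B (λ j j<m → A≗B (suc j) (s≤s j<m)))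

bitℕ : Bool → ℕ
bitℕ true = 1
bitℕ false = 0

bitℕ+bitℕ≡1⇒≡not : ∀ {a b} → bitℕ a + bitℕ b ≡ 1 → a ≡ not b
bitℕ+bitℕ≡1⇒≡not {false} {true} _ = refl
bitℕ+bitℕ≡1⇒≡not {true} {false} _ = refl

Σℕ : ℕ → (ℕ → ℕ) → ℕ
Σℕ zero h = 0
Σℕ (suc m) h = h 0 + Σℕ m (h ∘ suc)

Σℕ-cong : ∀ m g h → (∀ k → k < m → g k ≡ h k) → Σℕ m g ≡ Σℕ m h
Σℕ-cong zero g h g≗h = refl
Σℕ-cong (suc m) g h g≗h = cong₂ _+_ (g≗h 0 (s≤s z≤n)) (Σℕ-cong m _ _ (λ k k<m → g≗h (suc k) (s≤s k<m)))

Σℕ-pairs : ∀ k h → Σℕ (2 * k) h ≡ Σℕ k (λ i → h (2 * i) + h (suc (2 * i)))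
Σℕ-pairs zero h = refl
Σℕ-pairs (suc k) h = begin
    Σℕ (2 * suc k) h
  ≡⟨ cong (λ m → Σℕ m h) (ℕₚ.*-suc 2 k) ⟩
    h 0 + (h 1 + Σℕ (2 * k) (h ∘ suc ∘ suc))
  ≡⟨ sym (ℕₚ.+-assoc (h 0) (h 1) _) ⟩
    (h 0 + h 1) + Σℕ (2 * k) (h ∘ suc ∘ suc)
  ≡⟨ cong ((h 0 + h 1) +_) (Σℕ-pairs k (h ∘ suc ∘ suc)) ⟩
    (h 0 + h 1) + Σℕ k (λ i → h (suc (suc (2 * i))) + h (suc (suc (suc (2 * i)))))
  ≡⟨ cong ((h 0 + h 1) +_) (Σℕ-cong k _ _ (λ i _ → cong₂ _+_ (cong h (sym (ℕₚ.*-suc 2 i))) (cong (h ∘ suc) (sym (ℕₚ.*-suc 2 i))))) ⟩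
    (h 0 + h 1) + Σℕ k (λ i → h (2 * suc i) + h (suc (2 * suc i)))
  ∎
  where open ≡-Reasoning

Σℕ-const-1 : ∀ k → Σℕ k (λ _ → 1) ≡ k
Σℕ-const-1 zero = refl
Σℕ-const-1 (suc k) = cong suc (Σℕ-const-1 k)

Σℕ≤length : ∀ m h → (∀ k → k < m → h k ≤ 1) → Σℕ m h ≤ m
Σℕ≤length zero h _ = z≤n
Σℕ≤length (suc m) h h≤1 = ℕₚ.+-mono-≤ (h≤1 0 (s≤s z≤n)) (Σℕ≤length m (h ∘ suc) (λ k k<m → h≤1 (suc k) (s≤s k<m)))

Σℕ≡length⇒all-1 : ∀ m h → (∀ k → k < m → h k ≤ 1) → Σℕ m h ≡ m → ∀ k → k < m → h k ≡ 1
Σℕ≡length⇒all-1 (suc m) h h≤1 Σ≡1+m = all-1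
  where
  tail≤1 : ∀ k → k < m → h (suc k) ≤ 1
  tail≤1 k k<m = h≤1 (suc k) (s≤s k<m)

  head≡1 : h 0 ≡ 1
  head≡1 = by-value (h 0) refl (h≤1 0 (s≤s z≤n))
    where
    by-value : ∀ x → h 0 ≡ x → x ≤ 1 → h 0 ≡ 1
    by-value 0 h0≡0 _ = ⊥-elim (ℕₚ.1+n≰n (subst (_≤ m) (trans (cong (_+ Σℕ m (h ∘ suc)) (sym h0≡0)) Σ≡1+m)
                                                       (Σℕ≤length m (h ∘ suc) tail≤1)))
    by-value 1 h0≡1 _ = h0≡1
    by-value (suc (suc _)) _ (s≤s ())

  all-1 : ∀ k → k < suc m → h k ≡ 1
  all-1 zero _ = head≡1
  all-1 (suc k) (s≤s k<m) = Σℕ≡length⇒all-1 m (h ∘ suc) tail≤1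
    (ℕₚ.suc-injective (trans (cong (_+ Σℕ m (h ∘ suc)) (sym head≡1)) Σ≡1+m)) k k<m

∣fromBits∣ : ∀ k f → ∣ fromBits k f ∣ ≡ Σℕ k (bitℕ ∘ f)
∣fromBits∣ zero f = refl
∣fromBits∣ (suc k) f with f 0
... | true = cong suc (∣fromBits∣ k (f ∘ suc))
... | false = ∣fromBits∣ k (f ∘ suc)

∣∣≡Σℕ-bit : ∀ {m} (B : Subset m) k → m ≤ k → ∣ B ∣ ≡ Σℕ k (bitℕ ∘ bit B)
∣∣≡Σℕ-bit [] k _ = sym (Σℕ-zero k)
  where
  Σℕ-zero : ∀ k → Σℕ k (λ _ → 0) ≡ 0
  Σℕ-zero zero = refl
  Σℕ-zero (suc k) = Σℕ-zero k
∣∣≡Σℕ-bit (true ∷ B) (suc k) (s≤s m≤k) = cong suc (∣∣≡Σℕ-bit B k m≤k)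
∣∣≡Σℕ-bit (false ∷ B) (suc k) (s≤s m≤k) = ∣∣≡Σℕ-bit B k m≤k

module _ {A : Set} (_≟_ : DecidableEquality A) where

  remove : A → List A → List A
  remove x [] = []
  remove x (y ∷ ys) with x ≟ y
  ... | yes _ = ys
  ... | no _ = y ∷ remove x ys

  length-remove : ∀ {x ys} → x Mem.∈ ys → suc (length (remove x ys)) ≡ length ys
  length-remove {x} {y ∷ ys} x∈ys with x ≟ y
  ... | yes _ = refl
  length-remove {x} {y ∷ ys} (here x≡y) | no x≢y = ⊥-elim (x≢y x≡y)
  length-remove {x} {y ∷ ys} (there x∈ys) | no _ = cong suc (length-remove x∈ys)

  ∈-remove : ∀ {x z ys} → z Mem.∈ ys → ¬ z ≡ x → z Mem.∈ remove x ys
  ∈-remove {x} {z} {y ∷ ys} z∈ys z≢x with x ≟ y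
  ∈-remove (here z≡y) z≢x | yes x≡y = ⊥-elim (z≢x (trans z≡y (sym x≡y)))
  ∈-remove (there z∈ys) z≢x | yes _ = z∈ys
  ∈-remove (here z≡y) z≢x | no _ = here z≡y
  ∈-remove (there z∈ys) z≢x | no _ = there (∈-remove z∈ys z≢x)

  Unique⇒length-≤ : ∀ {xs ys} → Unique xs → (∀ {x} → x Mem.∈ xs → x Mem.∈ ys) → length xs ≤ length ys
  Unique⇒length-≤ {[]} _ _ = z≤n
  Unique⇒length-≤ {x ∷ xs} {ys} (x∉xs ∷ unique) xs⊆ys =
    ℕₚ.≤-trans (s≤s (Unique⇒length-≤ unique λ z∈xs → ∈-remove (xs⊆ys (there z∈xs)) (λ z≡x → All.lookup x∉xs z∈xs (sym z≡x))))
               (ℕₚ.≤-reflexive (length-remove (xs⊆ys (here refl))))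

  CardIs-unique : ∀ {P : A → Set} {k k′} → CardIs P k → CardIs P k′ → k ≡ k′
  CardIs-unique (xs , unique , xs⇔P , refl) (ys , unique′ , ys⇔P , refl) = ℕₚ.≤-antisym
    (Unique⇒length-≤ unique λ {x} x∈xs → Equivalence.from (ys⇔P x) (Equivalence.to (xs⇔P x) x∈xs))
    (Unique⇒length-≤ unique′ λ {x} x∈ys → Equivalence.from (xs⇔P x) (Equivalence.to (ys⇔P x) x∈ys))

toList : ∀ {m} → Subset m → List (Fin m)
toList [] = []
toList (true ∷ B) = Fin.zero ∷ map Fin.suc (toList B)
toList (false ∷ B) = map Fin.suc (toList B)

length-toList : ∀ {m} (B : Subset m) → length (toList B) ≡ ∣ B ∣
length-toList [] = refl
length-toList (true ∷ B) = cong suc (trans (Listₚ.length-map Fin.suc (toList B)) (length-toList B))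
length-toList (false ∷ B) = trans (Listₚ.length-map Fin.suc (toList B)) (length-toList B)

∈-toList⁻ : ∀ {m} (B : Subset m) {t} → t Mem.∈ toList B → t ∈ B
∈-toList⁻ (true ∷ B) (here refl) = here
∈-toList⁻ (true ∷ B) (there t∈) with Memₚ.∈-map⁻ Fin.suc t∈
... | _ , t∈B , refl = there (∈-toList⁻ B t∈B)
∈-toList⁻ (false ∷ B) t∈ with Memₚ.∈-map⁻ Fin.suc t∈
... | _ , t∈B , refl = there (∈-toList⁻ B t∈B)

∈-toList⁺ : ∀ {m} (B : Subset m) {t} → t ∈ B → t Mem.∈ toList B
∈-toList⁺ (true ∷ B) here = here refl
∈-toList⁺ (true ∷ B) (there t∈B) = there (Memₚ.∈-map⁺ Fin.suc (∈-toList⁺ B t∈B))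
∈-toList⁺ (false ∷ B) (there t∈B) = Memₚ.∈-map⁺ Fin.suc (∈-toList⁺ B t∈B)

toList-unique : ∀ {m} (B : Subset m) → Unique (toList B)
toList-unique [] = []
toList-unique (true ∷ B) = All.tabulate zero∉ ∷ Uniqueₚ.map⁺ Finₚ.suc-injective (toList-unique B)
  where
  zero∉ : ∀ {t} → t Mem.∈ map Fin.suc (toList B) → ¬ Fin.zero ≡ t
  zero∉ t∈ 0≡t with Memₚ.∈-map⁻ Fin.suc t∈
  zero∉ t∈ refl | _ , _ , ()
toList-unique (false ∷ B) = Uniqueₚ.map⁺ Finₚ.suc-injective (toList-unique B)

Unique⇒length≤∣∣ : ∀ {m} (B : Subset m) {xs : List (Fin m)} → Unique xs → (∀ {x} → x Mem.∈ xs → x ∈ B) → length xs ≤ ∣ B ∣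
Unique⇒length≤∣∣ B unique xs⊆B = ℕₚ.≤-trans (Unique⇒length-≤ Finₚ._≟_ unique (∈-toList⁺ B ∘ xs⊆B)) (ℕₚ.≤-reflexive (length-toList B))

CardIs-∈ : ∀ {m} (B : Subset m) (P : Fin m → Set) → (∀ t → P t ⇔ t ∈ B) → CardIs P ∣ B ∣
CardIs-∈ B P P⇔∈B = toList B , toList-unique B ,
  (λ t → mk⇔ (Equivalence.from (P⇔∈B t) ∘ ∈-toList⁻ B) (∈-toList⁺ B ∘ Equivalence.to (P⇔∈B t))) , length-toList B

subsetsOfSize : (m j : ℕ) → List (Subset m)
subsetsOfSize zero zero = [] ∷ []
subsetsOfSize zero (suc j) = []
subsetsOfSize (suc m) zero = map (false ∷_) (subsetsOfSize m zero)
subsetsOfSize (suc m) (suc j) = map (true ∷_) (subsetsOfSize m j) ++ map (false ∷_) (subsetsOfSize m (suc j))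

length-subsetsOfSize : ∀ m j → length (subsetsOfSize m j) ≡ m C j
length-subsetsOfSize zero zero = refl
length-subsetsOfSize zero (suc j) = refl
length-subsetsOfSize (suc m) zero = trans (Listₚ.length-map (false ∷_) (subsetsOfSize m zero)) (length-subsetsOfSize m zero)
length-subsetsOfSize (suc m) (suc j) = begin
    length (map (true ∷_) (subsetsOfSize m j) ++ map (false ∷_) (subsetsOfSize m (suc j)))
  ≡⟨ Listₚ.length-++ (map (true ∷_) (subsetsOfSize m j)) ⟩
    length (map (true ∷_) (subsetsOfSize m j)) + length (map (false ∷_) (subsetsOfSize m (suc j)))
  ≡⟨ cong₂ _+_ (trans (Listₚ.length-map (true ∷_) (subsetsOfSize m j)) (length-subsetsOfSize m j))
               (trans (Listₚ.length-map (false ∷_) (subsetsOfSize m (suc j))) (length-subsetsOfSize m (suc j))) ⟩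
    m C j + m C suc j
  ≡⟨ nCk+nC[k+1]≡[n+1]C[k+1] m j ⟩
    suc m C suc j ∎
  where open ≡-Reasoning

∈-subsetsOfSize⁻ : ∀ m j {s} → s Mem.∈ subsetsOfSize m j → ∣ s ∣ ≡ j
∈-subsetsOfSize⁻ zero zero (here refl) = refl
∈-subsetsOfSize⁻ (suc m) zero s∈ with Memₚ.∈-map⁻ (false ∷_) s∈
... | _ , s∈′ , refl = ∈-subsetsOfSize⁻ m zero s∈′
∈-subsetsOfSize⁻ (suc m) (suc j) s∈ with Memₚ.∈-++⁻ (map (true ∷_) (subsetsOfSize m j)) s∈
... | inj₁ s∈₁ with Memₚ.∈-map⁻ (true ∷_) s∈₁
...   | _ , s∈′ , refl = cong suc (∈-subsetsOfSize⁻ m j s∈′)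
∈-subsetsOfSize⁻ (suc m) (suc j) s∈ | inj₂ s∈₂ with Memₚ.∈-map⁻ (false ∷_) s∈₂
...   | _ , s∈′ , refl = ∈-subsetsOfSize⁻ m (suc j) s∈′

∈-subsetsOfSize⁺ : ∀ m (s : Subset m) → s Mem.∈ subsetsOfSize m ∣ s ∣
∈-subsetsOfSize⁺ zero [] = here refl
∈-subsetsOfSize⁺ (suc m) (true ∷ s) = Memₚ.∈-++⁺ˡ (Memₚ.∈-map⁺ (true ∷_) (∈-subsetsOfSize⁺ m s))
∈-subsetsOfSize⁺ (suc m) (false ∷ s) with ∣ s ∣ | ∈-subsetsOfSize⁺ m s
... | zero | s∈ = Memₚ.∈-map⁺ (false ∷_) s∈
... | suc j | s∈ = Memₚ.∈-++⁺ʳ (map (true ∷_) (subsetsOfSize m j)) (Memₚ.∈-map⁺ (false ∷_) s∈)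

subsetsOfSize-unique : ∀ m j → Unique (subsetsOfSize m j)
subsetsOfSize-unique zero zero = All.[] ∷ []
subsetsOfSize-unique zero (suc j) = []
subsetsOfSize-unique (suc m) zero = Uniqueₚ.map⁺ Vecₚ.∷-injectiveʳ (subsetsOfSize-unique m zero)
subsetsOfSize-unique (suc m) (suc j) =
  Uniqueₚ.++⁺ (Uniqueₚ.map⁺ Vecₚ.∷-injectiveʳ (subsetsOfSize-unique m j)) (Uniqueₚ.map⁺ Vecₚ.∷-injectiveʳ (subsetsOfSize-unique m (suc j))) disjoint
  where
  disjoint : ∀ {v} → ¬ (v Mem.∈ map (true ∷_) (subsetsOfSize m j) × v Mem.∈ map (false ∷_) (subsetsOfSize m (suc j)))
  disjoint (v∈₁ , v∈₂) with Memₚ.∈-map⁻ (true ∷_) v∈₁ | Memₚ.∈-map⁻ (false ∷_) v∈₂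
  ... | _ , _ , refl | _ , _ , ()

-- The set (B ∖ {b}) ∪ {x ∉ B : b ≺ x} whose spanning makes b internally active.
OthersOrAbove : ∀ {M} → Subset M → Fin M → Fin M → Set
OthersOrAbove B b t = ((t ∈ B) × ¬ (t ≡ b)) ⊎ ((t ∉ B) × (toℕ b < toℕ t))

-- The set {x} ∪ {b ∈ B : b ≺ x} whose independence makes x externally active.
SelfOrBelow : ∀ {M} → Subset M → Fin M → Fin M → Set
SelfOrBelow B x t = (t ≡ x) ⊎ ((t ∈ B) × (toℕ t < toℕ x))

∈⇒∉OthersOrAbove : ∀ {M} (B : Subset M) b → b ∈ B → ¬ OthersOrAbove B b b
∈⇒∉OthersOrAbove B b b∈B (inj₁ (_ , b≢b)) = b≢b refl
∈⇒∉OthersOrAbove B b b∈B (inj₂ (b∉B , _)) = b∉B b∈B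

above⇒OthersOrAbove : ∀ {M} (B : Subset M) b t → toℕ b < toℕ t → OthersOrAbove B b t
above⇒OthersOrAbove B b t b<t with bit B (toℕ t) in eq
... | true = inj₁ (bit≡true⇒∈ refl eq , λ t≡b → ℕₚ.<-irrefl (cong toℕ (sym t≡b)) b<t)
... | false = inj₂ (bit≡false⇒∉ refl eq , b<t)

other⇒OthersOrAbove : ∀ {M} (B : Subset M) b t → t ∈ B → ¬ toℕ t ≡ toℕ b → OthersOrAbove B b t
other⇒OthersOrAbove B b t t∈B t≢b = inj₁ (t∈B , t≢b ∘ cong toℕ)

interleaveAt : (ℕ → Bool) → (ℕ → Bool) → ℕ → ℕ → Bool
interleaveAt e o zero i = e i
interleaveAt e o (suc _) i = o i

pairSubset : (n : ℕ) → (ℕ → Bool) → (ℕ → Bool) → Subset (2 * n)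
pairSubset n e o = fromBits (2 * n) (λ k → interleaveAt e o (k % 2) (k / 2))

bit-pairSubset-even : ∀ n e o i → i < n → bit (pairSubset n e o) (2 * i) ≡ e i
bit-pairSubset-even n e o i i<n = trans (bit-fromBits (2 * n) (λ k → interleaveAt e o (k % 2) (k / 2)) (2 * i) (2*-mono-< i<n))
                                        (cong₂ (interleaveAt e o) ([2*q]%2≡0 i) ([2*q]/2≡q i))

bit-pairSubset-odd : ∀ n e o i → i < n → bit (pairSubset n e o) (suc (2 * i)) ≡ o i
bit-pairSubset-odd n e o i i<n = trans (bit-fromBits (2 * n) (λ k → interleaveAt e o (k % 2) (k / 2)) (suc (2 * i)) (1+2*-mono-< i<n))
                                       (cong₂ (interleaveAt e o) ([1+2*q]%2≡1 i) ([1+2*q]/2≡q i))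

∣pairSubset∣ : ∀ n e o → ∣ pairSubset n e o ∣ ≡ Σℕ n (λ i → bitℕ (e i) + bitℕ (o i))
∣pairSubset∣ n e o = begin
    ∣ pairSubset n e o ∣
  ≡⟨ ∣fromBits∣ (2 * n) f ⟩
    Σℕ (2 * n) (bitℕ ∘ f)
  ≡⟨ Σℕ-pairs n (bitℕ ∘ f) ⟩
    Σℕ n (λ i → bitℕ (f (2 * i)) + bitℕ (f (suc (2 * i))))
  ≡⟨ Σℕ-cong n _ _ (λ i _ → cong₂ (λ x y → bitℕ x + bitℕ y) (cong₂ (interleaveAt e o) ([2*q]%2≡0 i) ([2*q]/2≡q i))
                                                            (cong₂ (interleaveAt e o) ([1+2*q]%2≡1 i) ([1+2*q]/2≡q i))) ⟩
    Σℕ n (λ i → bitℕ (e i) + bitℕ (o i)) ∎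
  where
  open ≡-Reasoning
  f = λ k → interleaveAt e o (k % 2) (k / 2)


¬internallyActive-if-nothing-above : ∀ n (B : Subset (2 * n)) b → LinIndep n (_∈ B) → b ∈ B →
  (∀ t → toℕ b < toℕ t → t ∈ B) → ¬ Spans n (OthersOrAbove B b)
¬internallyActive-if-nothing-above n B b indep b∈B above∈B spans with spans (xvec n b)
... | c , c⊆ , c↦xb = combination⇒¬linIndep n (_∈ B) (OthersOrAbove B b) b b∈B (∈⇒∉OthersOrAbove B b b∈B) ⊆B c c⊆ c↦xb indep
  where
  ⊆B : ∀ t → OthersOrAbove B b t → t ∈ B
  ⊆B t (inj₁ (t∈B , _)) = t∈B
  ⊆B t (inj₂ (_ , b<t)) = above∈B t b<t

pair-full⇒¬internallyActive : ∀ n (B : Subset (2 * n)) I (b b′ : Fin (2 * n)) → toℕ b ≡ 2 * I → toℕ b′ ≡ suc (2 * I) →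
  b ∈ B → b′ ∈ B → LinIndep n (_∈ B) → ¬ Spans n (OthersOrAbove B b)
pair-full⇒¬internallyActive n B I b b′ b≡2I b′≡2I+1 b∈B b′∈B indep spans with spans (xvec n b)
... | c , c⊆ , c↦xb = combination⇒¬linIndep n (_∈ B) T b b∈B b∉T T⊆B (g ∘ toℕ) g⊆T g↦xb indep
  where
  L = 2 * I
  d = extend c

  d[L]≡0 : d L ≡ 0ℚ
  d[L]≡0 = trans (cong d (sym b≡2I)) (trans (extend-toℕ c b) (c⊆ b (∈⇒∉OthersOrAbove B b b∈B)))

  g : ℕ → ℚ
  g k = cut L d k +ℚ δ k (suc L)

  T : Fin (2 * n) → Set
  T t = (toℕ t < L × t ∈ B) ⊎ t ≡ b′

  b∉T : ¬ T b
  b∉T (inj₁ (b<L , _)) = ℕₚ.<-irrefl b≡2I b<L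
  b∉T (inj₂ b≡b′) = ℕₚ.even≢odd I I (trans (sym b≡2I) (trans (cong toℕ b≡b′) b′≡2I+1))

  T⊆B : ∀ t → T t → t ∈ B
  T⊆B t (inj₁ (_ , t∈B)) = t∈B
  T⊆B t (inj₂ refl) = b′∈B

  g⊆T : ∀ t → ¬ T t → g (toℕ t) ≡ 0ℚ
  g⊆T t t∉T = by-position (toℕ t <? L)
    where
    by-position : Dec (toℕ t < L) → g (toℕ t) ≡ 0ℚ
    by-position (yes t<L) = cong₂ _+ℚ_ (trans (cut-≤ L d (toℕ t) d[L]≡0 (ℕₚ.<⇒≤ t<L)) (trans (extend-toℕ c t) (c⊆ t t∉)))
                                      (δ-≢ λ t≡L+1 → ℕₚ.<-asym t<L (subst (L <_) (sym t≡L+1) (ℕₚ.n<1+n L)))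
      where
      t∉ : ¬ OthersOrAbove B b t
      t∉ (inj₁ (t∈B , _)) = t∉T (inj₁ (t<L , t∈B))
      t∉ (inj₂ (_ , b<t)) = ℕₚ.<-asym t<L (subst (_< toℕ t) b≡2I b<t)
    by-position (no t≮L) = cong₂ _+ℚ_ (cut-≥ L d (toℕ t) (ℕₚ.≮⇒≥ t≮L))
                                     (δ-≢ λ t≡L+1 → t∉T (inj₂ (Finₚ.toℕ-injective (trans t≡L+1 (sym b′≡2I+1)))))

  g≥2n≡0 : ∀ k → 2 * n ≤ k → g k ≡ 0ℚ
  g≥2n≡0 k 2n≤k = cong₂ _+ℚ_ (cut-≥ L d k (ℕₚ.≤-trans (ℕₚ.<⇒≤ (subst (_< 2 * n) b≡2I (Finₚ.toℕ<n b))) 2n≤k))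
    (δ-≢ λ k≡L+1 → ℕₚ.<⇒≱ (subst (_< 2 * n) b′≡2I+1 (Finₚ.toℕ<n b′)) (subst (2 * n ≤_) k≡L+1 2n≤k))

  coord-d : ∀ j → j < n → coord d j ≡ xvecℕ L j
  coord-d j j<n = begin
    coord d j                             ≡⟨ coord-extend n c (xvec n b) c↦xb j j<n ⟩
    extend (xvec n b) j                   ≡⟨ extend-fromℕ< (xvec n b) j<n ⟩
    xvecℕ (toℕ b) (toℕ (fromℕ< j<n))      ≡⟨ cong₂ xvecℕ b≡2I (Finₚ.toℕ-fromℕ< j<n) ⟩
    xvecℕ L j                             ∎
    where open ≡-Reasoning

  g↦xb : ∀ i → sumℚ (λ t → g (toℕ t) *ℚ xvec n t i) ≡ xvec n b i
  g↦xb i = begin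
    sumℚ (λ t → g (toℕ t) *ℚ xvec n t i)       ≡⟨ sumℚ-xvec≡coord n (g ∘ toℕ) i ⟩
    coord (extend {2 * n} (g ∘ toℕ)) (toℕ i)   ≡⟨ coord-cong (extend {2 * n} (g ∘ toℕ)) g (extend-tabulate g g≥2n≡0) (toℕ i) ⟩
    coord g (toℕ i)                            ≡⟨ coord-truncate-pair I d (toℕ i) d[L]≡0 (const (coord-d (toℕ i) (Finₚ.toℕ<n i))) ⟩
    xvecℕ L (toℕ i)                            ≡⟨ cong (λ k → xvecℕ k (toℕ i)) (sym b≡2I) ⟩
    xvec n b i                                 ∎
    where open ≡-Reasoning

-- val*(B) = ∣B∣ leaves no room for an element of B that is not internally active.
internal⇒internallyActive : ∀ n (B : Subset (2 * n)) → ∣ B ∣ ≡ n → Internal n B →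
  ∀ b → b ∈ B → ¬ ¬ Spans n (OthersOrAbove B b)
internal⇒internallyActive n B ∣B∣≡n (xs , unique , xs⇔ , length≡n) b b∈B ¬active =
  ℕₚ.1+n≰n (subst₂ _≤_ (cong suc length≡n) ∣B∣≡n (Unique⇒length≤∣∣ B (All.tabulate b≢ ∷ unique) ⊆B))
  where
  b∉xs : ¬ b Mem.∈ xs
  b∉xs b∈xs = ¬active (proj₂ (Equivalence.to (xs⇔ b) b∈xs))
  b≢ : ∀ {t} → t Mem.∈ xs → ¬ b ≡ t
  b≢ t∈xs refl = b∉xs t∈xs
  ⊆B : ∀ {t} → t Mem.∈ (b ∷ xs) → t ∈ B
  ⊆B (here refl) = b∈B
  ⊆B {t} (there t∈xs) = proj₁ (Equivalence.to (xs⇔ t) t∈xs)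

-- For s ⊆ {0, …, m-1}, the basis B_s takes e_i from pair i when i ∈ s and e_i - e_{i-1} otherwise.
module PairBases (m : ℕ) where

  n : ℕ
  n = suc m

  basisOf : Subset m → Subset (2 * n)
  basisOf s = pairSubset n (not ∘ bit s) (bit s)

  bit-basisOf-even : ∀ s i → i < n → bit (basisOf s) (2 * i) ≡ not (bit s i)
  bit-basisOf-even s = bit-pairSubset-even n (not ∘ bit s) (bit s)

  bit-basisOf-odd : ∀ s i → i < n → bit (basisOf s) (suc (2 * i)) ≡ bit s i
  bit-basisOf-odd s = bit-pairSubset-odd n (not ∘ bit s) (bit s)

  ∣basisOf∣ : ∀ s → ∣ basisOf s ∣ ≡ n
  ∣basisOf∣ s = begin
      ∣ basisOf s ∣                                       ≡⟨ ∣pairSubset∣ n (not ∘ bit s) (bit s) ⟩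
      Σℕ n (λ i → bitℕ (not (bit s i)) + bitℕ (bit s i))  ≡⟨ Σℕ-cong n _ _ (λ i _ → one-of-pair (bit s i)) ⟩
      Σℕ n (λ _ → 1)                                     ≡⟨ Σℕ-const-1 n ⟩
      n                                                  ∎
    where
    open ≡-Reasoning
    one-of-pair : ∀ b → bitℕ (not b) + bitℕ b ≡ 1
    one-of-pair true = refl
    one-of-pair false = refl

  basisOf-avoids-pairs : ∀ s i → i < n → Avoids (_∈ basisOf s) (2 * i) ⊎ Avoids (_∈ basisOf s) (suc (2 * i))
  basisOf-avoids-pairs s i i<n with bit s i in eq
  ... | true = inj₁ λ t t≡2i → bit≡false⇒∉ t≡2i (trans (bit-basisOf-even s i i<n) (cong not eq))
  ... | false = inj₂ λ t t≡2i+1 → bit≡false⇒∉ t≡2i+1 (trans (bit-basisOf-odd s i i<n) eq)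

  chosenShare : Subset m → ℕ → Share
  chosenShare s i with bit s i
  ... | true = oddOnly
  ... | false = evenOnly

  chosenShare≢neither : ∀ s i → ¬ chosenShare s i ≡ neither
  chosenShare≢neither s i with bit s i
  ... | true = λ ()
  ... | false = λ ()

  chosen-even∈ : ∀ s i → i < n → UsesEven (chosenShare s i) → ∀ t → toℕ t ≡ 2 * i → t ∈ basisOf s
  chosen-even∈ s i i<n uses t t≡2i with bit s i in eq
  ... | false = bit≡true⇒∈ t≡2i (trans (bit-basisOf-even s i i<n) (cong not eq))

  chosen-odd∈ : ∀ s i → i < n → UsesOdd (chosenShare s i) → ∀ t → toℕ t ≡ suc (2 * i) → t ∈ basisOf s
  chosen-odd∈ s i i<n uses t t≡2i+1 with bit s i in eq
  ... | true = bit≡true⇒∈ t≡2i+1 (trans (bit-basisOf-odd s i i<n) eq)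

  isBasis-basisOf : ∀ s → IsBasis n (basisOf s)
  isBasis-basisOf s = ∣basisOf∣ s , linIndep-if-pairs-avoided n _ (basisOf-avoids-pairs s) , spans-by-schedules n _ schedule
    where
    schedule : ∀ w → Schedule n (_∈ basisOf s) (extend w)
    schedule w = record
      { share = chosenShare s
      ; balanced = λ i _ ≡neither → ⊥-elim (chosenShare≢neither s i ≡neither)
      ; even∈S = chosen-even∈ s
      ; odd∈S = chosen-odd∈ s
      }

  chosen-even-other : ∀ s (b : Fin (2 * n)) i → i < n → UsesEven (chosenShare s i) →
    ¬ toℕ b ≡ 2 * i → ∀ t → toℕ t ≡ 2 * i → OthersOrAbove (basisOf s) b t
  chosen-even-other s b i i<n uses b≢2i t t≡2i =
    other⇒OthersOrAbove (basisOf s) b t (chosen-even∈ s i i<n uses t t≡2i) (λ t≡b → b≢2i (trans (sym t≡b) t≡2i))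

  chosen-odd-other : ∀ s (b : Fin (2 * n)) i → i < n → UsesOdd (chosenShare s i) →
    ¬ toℕ b ≡ suc (2 * i) → ∀ t → toℕ t ≡ suc (2 * i) → OthersOrAbove (basisOf s) b t
  chosen-odd-other s b i i<n uses b≢2i+1 t t≡2i+1 =
    other⇒OthersOrAbove (basisOf s) b t (chosen-odd∈ s i i<n uses t t≡2i+1) (λ t≡b → b≢2i+1 (trans (sym t≡b) t≡2i+1))

  -- x_{2k} = e_k - e_{k-1} is recovered from e_k = x_{2k+1} ∉ B_s.
  shareAvoidingEven : Subset m → ℕ → ℕ → Share
  shareAvoidingEven s k i with i ≟ k
  ... | yes _ = oddOnly
  ... | no _ = chosenShare s i

  even-internallyActive : ∀ s b k → toℕ b ≡ 2 * k → Spans n (OthersOrAbove (basisOf s) b)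
  even-internallyActive s b k b≡2k = spans-by-schedules n _ λ w → record
    { share = shareAvoidingEven s k
    ; balanced = balanced
    ; even∈S = even∈
    ; odd∈S = odd∈
    }
    where
    balanced : ∀ {w} i → i < n → shareAvoidingEven s k i ≡ neither → BackSubstitution.pairTotal n w (shareAvoidingEven s k) i ≡ 0ℚ
    balanced i _ ≡neither with i ≟ k
    ... | no _ = ⊥-elim (chosenShare≢neither s i ≡neither)
    even∈ : ∀ i → i < n → UsesEven (shareAvoidingEven s k i) → ∀ t → toℕ t ≡ 2 * i → OthersOrAbove (basisOf s) b t
    even∈ i i<n uses with i ≟ k
    ... | no i≢k = chosen-even-other s b i i<n uses (λ b≡2i → i≢k (2*-injective (trans (sym b≡2i) b≡2k)))
    odd∈ : ∀ i → i < n → UsesOdd (shareAvoidingEven s k i) → ∀ t → toℕ t ≡ suc (2 * i) → OthersOrAbove (basisOf s) b t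
    odd∈ i i<n uses t t≡2i+1 with i ≟ k
    ... | yes refl = above⇒OthersOrAbove (basisOf s) b t (subst₂ _<_ (sym b≡2k) (sym t≡2i+1) (ℕₚ.n<1+n _))
    ... | no i≢k = chosen-odd-other s b i i<n uses (λ b≡2i+1 → ℕₚ.even≢odd k i (trans (sym b≡2k) b≡2i+1)) t t≡2i+1

  -- e_k = x_{2k+1} is recovered from x_{2k+2} and x_{2k+3}, both above it, cancelling the surplus e_{k+1}.
  shareAvoidingOdd : Subset m → ℕ → ℚ → ℕ → Share
  shareAvoidingOdd s k v i with i ≟ k
  ... | yes _ = neither
  ... | no _ with i ≟ suc k
  ...   | yes _ = both v
  ...   | no _ = chosenShare s i

  shareAvoidingOdd-above : ∀ s k v → shareAvoidingOdd s k v (suc k) ≡ both v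
  shareAvoidingOdd-above s k v with suc k ≟ k
  ... | yes 1+k≡k = ⊥-elim (ℕₚ.1+n≢n 1+k≡k)
  ... | no _ with suc k ≟ suc k
  ...   | yes _ = refl
  ...   | no 1+k≢1+k = ⊥-elim (1+k≢1+k refl)

  odd-internallyActive : ∀ s b k → toℕ b ≡ suc (2 * k) → suc k < n → Spans n (OthersOrAbove (basisOf s) b)
  odd-internallyActive s b k b≡2k+1 k+1<n = spans-by-schedules n _ λ w → record
    { share = share w
    ; balanced = balanced w
    ; even∈S = even∈ w
    ; odd∈S = odd∈ w
    }
    where
    share : (Fin n → ℚ) → ℕ → Share
    share w = shareAvoidingOdd s k (negℚ (extend w k))

    balanced : ∀ w i → i < n → share w i ≡ neither → BackSubstitution.pairTotal n (extend w) (share w) i ≡ 0ℚ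
    balanced w i _ ≡neither with i ≟ k
    ... | yes refl = begin
        pairTotal i                                      ≡⟨ pairTotal-step i k+1<n ⟩
        extend w i +ℚ coeff (2 * suc i)                  ≡⟨ cong (extend w i +ℚ_) (coeff-even (suc i)) ⟩
        extend w i +ℚ evenPart (share w (suc i)) _        ≡⟨ cong (λ sh → extend w i +ℚ evenPart sh (pairTotal (suc i)))
                                                               (shareAvoidingOdd-above s i _) ⟩
        extend w i +ℚ negℚ (extend w i)                  ≡⟨ ℚₚ.+-inverseʳ (extend w i) ⟩
        0ℚ                                               ∎
      where
      open ≡-Reasoning
      open BackSubstitution n (extend w) (share w)
    ... | no _ with i ≟ suc k
    ...   | no _ = ⊥-elim (chosenShare≢neither s i ≡neither)

    even∈ : ∀ w i → i < n → UsesEven (share w i) → ∀ t → toℕ t ≡ 2 * i → OthersOrAbove (basisOf s) b t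
    even∈ w i i<n uses t t≡2i with i ≟ k
    ... | no i≢k with i ≟ suc k
    ...   | yes refl = above⇒OthersOrAbove (basisOf s) b t (subst₂ _<_ (sym b≡2k+1) (sym t≡2i) (ℕₚ.≤-reflexive (sym (2*[1+q]≡2+2*q k))))
    ...   | no _ = chosen-even-other s b i i<n uses (λ b≡2i → ℕₚ.even≢odd i k (trans (sym b≡2i) b≡2k+1)) t t≡2i

    odd∈ : ∀ w i → i < n → UsesOdd (share w i) → ∀ t → toℕ t ≡ suc (2 * i) → OthersOrAbove (basisOf s) b t
    odd∈ w i i<n uses t t≡2i+1 with i ≟ k
    ... | no i≢k with i ≟ suc k
    ...   | yes refl = above⇒OthersOrAbove (basisOf s) b t (subst₂ _<_ (sym b≡2k+1) (sym t≡2i+1) (ℕₚ.m<n⇒m<1+n (ℕₚ.≤-reflexive (sym (2*[1+q]≡2+2*q k)))))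
    ...   | no _ = chosen-odd-other s b i i<n uses (λ b≡2i+1 → i≢k (1+2*-injective (trans (sym b≡2i+1) b≡2k+1))) t t≡2i+1

  internallyActive : ∀ s b → b ∈ basisOf s → Spans n (OthersOrAbove (basisOf s) b)
  internallyActive s b b∈B with parity (toℕ b)
  ... | inj₁ (k , b≡2k) = even-internallyActive s b k b≡2k
  ... | inj₂ (k , b≡2k+1) = odd-internallyActive s b k b≡2k+1 (s≤s k<m)
    where
    k<n = 1+2*-cancel-< (subst (_< 2 * n) b≡2k+1 (Finₚ.toℕ<n b))
    k∈s : bit s k ≡ true
    k∈s = trans (sym (bit-basisOf-odd s k k<n)) (subst (λ x → bit (basisOf s) x ≡ true) b≡2k+1 (∈⇒bit≡true b∈B))
    k<m : k < m
    k<m with k <? m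
    ... | yes k<m = k<m
    ... | no k≮m with trans (sym k∈s) (bit-≥ s k (ℕₚ.≮⇒≥ k≮m))
    ...   | ()

  internal-basisOf : ∀ s → Internal n (basisOf s)
  internal-basisOf s = subst (CardIs _) (∣basisOf∣ s)
    (CardIs-∈ (basisOf s) _ λ b → mk⇔ proj₁ λ b∈B → b∈B , internallyActive s b b∈B)

  externallyActive : Subset m → Subset (2 * n)
  externallyActive s = pairSubset n (bit s) (λ _ → false)

  ∣externallyActive∣ : ∀ s → ∣ externallyActive s ∣ ≡ ∣ s ∣
  ∣externallyActive∣ s = begin
      ∣ externallyActive s ∣              ≡⟨ ∣pairSubset∣ n (bit s) (λ _ → false) ⟩
      Σℕ n (λ i → bitℕ (bit s i) + 0)     ≡⟨ Σℕ-cong n _ (bitℕ ∘ bit s) (λ i _ → ℕₚ.+-identityʳ _) ⟩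
      Σℕ n (bitℕ ∘ bit s)                 ≡⟨ sym (∣∣≡Σℕ-bit s n (ℕₚ.n≤1+n m)) ⟩
      ∣ s ∣                               ∎
    where open ≡-Reasoning

  -- Below an even x_{2i}, every pair misses one element; from pair i on, the odd elements are missing.
  externallyActive⇒ : ∀ s x → x ∈ externallyActive s → (x ∉ basisOf s) × LinIndep n (SelfOrBelow (basisOf s) x)
  externallyActive⇒ s x x∈ with parity (toℕ x)
  ... | inj₂ (i , x≡2i+1) with trans (sym (∈⇒bit≡true x∈)) (trans (cong (bit (externallyActive s)) x≡2i+1)
                                   (bit-pairSubset-odd n (bit s) (λ _ → false) i (1+2*-cancel-< (subst (_< 2 * n) x≡2i+1 (Finₚ.toℕ<n x)))))
  ...   | ()
  externallyActive⇒ s x x∈ | inj₁ (i , x≡2i) =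
    bit≡false⇒∉ x≡2i (trans (bit-basisOf-even s i i<n) (cong not i∈s)) ,
    linIndep-if-pairs-avoided n _ pair-avoided
    where
    i<n = 2*-cancel-< (subst (_< 2 * n) x≡2i (Finₚ.toℕ<n x))
    i∈s : bit s i ≡ true
    i∈s = trans (sym (bit-pairSubset-even n (bit s) (λ _ → false) i i<n)) (trans (cong (bit (externallyActive s)) (sym x≡2i)) (∈⇒bit≡true x∈))

    avoids : ∀ k → ¬ k ≡ toℕ x → bit (basisOf s) k ≡ false ⊎ toℕ x ≤ k → Avoids (SelfOrBelow (basisOf s) x) k
    avoids k k≢x _ t t≡k (inj₁ refl) = k≢x (sym t≡k)
    avoids k k≢x (inj₁ k∉B) t t≡k (inj₂ (t∈B , _)) = bit≡false⇒∉ t≡k k∉B t∈B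
    avoids k k≢x (inj₂ x≤k) t t≡k (inj₂ (_ , t<x)) = ℕₚ.<⇒≱ t<x (subst (toℕ x ≤_) (sym t≡k) x≤k)

    pair-avoided : ∀ l → l < n → Avoids (SelfOrBelow (basisOf s) x) (2 * l) ⊎ Avoids (SelfOrBelow (basisOf s) x) (suc (2 * l))
    pair-avoided l l<n with l <? i
    ... | no l≮i = inj₂ (avoids _ (λ 2l+1≡x → ℕₚ.even≢odd i l (trans (sym x≡2i) (sym 2l+1≡x)))
                       (inj₂ (subst (_≤ suc (2 * l)) (sym x≡2i) (ℕₚ.m≤n⇒m≤1+n (ℕₚ.*-monoʳ-≤ 2 (ℕₚ.≮⇒≥ l≮i))))))
    ... | yes l<i with bit s l in eq
    ...   | true = inj₁ (avoids _ (λ 2l≡x → ℕₚ.<⇒≢ l<i (2*-injective (trans 2l≡x x≡2i)))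
                          (inj₁ (trans (bit-basisOf-even s l l<n) (cong not eq))))
    ...   | false = inj₂ (avoids _ (λ 2l+1≡x → ℕₚ.even≢odd i l (trans (sym x≡2i) (sym 2l+1≡x)))
                          (inj₁ (trans (bit-basisOf-odd s l l<n) eq)))

  -- For x = x_{2i+1} ∉ B_s, the relation e_i = x_{2i} + e_{i-1} = … expresses x through chosen elements below it.
  shareBelow : Subset m → ℕ → ℕ → Share
  shareBelow s i j with j <? i
  ... | yes _ = chosenShare s j
  ... | no _ with j ≟ i
  ...   | yes _ = both 1ℚ
  ...   | no _ = neither

  shareBelow-above : ∀ s i j → i < j → shareBelow s i j ≡ neither
  shareBelow-above s i j i<j with j <? i
  ... | yes j<i = ⊥-elim (ℕₚ.<-asym i<j j<i)
  ... | no _ with j ≟ i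
  ...   | yes refl = ⊥-elim (ℕₚ.<-irrefl refl i<j)
  ...   | no _ = refl

  shareBelow-at : ∀ s i → shareBelow s i i ≡ both 1ℚ
  shareBelow-at s i with i <? i
  ... | yes i<i = ⊥-elim (ℕₚ.<-irrefl refl i<i)
  ... | no _ with i ≟ i
  ...   | yes _ = refl
  ...   | no i≢i = ⊥-elim (i≢i refl)

  totalWithin-0 : ∀ (share : ℕ → Share) j r → share (suc j) ≡ neither →
    BackSubstitution.totalWithin n (λ _ → 0ℚ) share j r ≡ 0ℚ
  totalWithin-0 share j zero _ = refl
  totalWithin-0 share j (suc zero) _ = refl
  totalWithin-0 share j (suc (suc r)) share≡neither rewrite share≡neither = refl

  odd-external⇒¬linIndep : ∀ s x i → toℕ x ≡ suc (2 * i) → bit s i ≡ false → ¬ LinIndep n (SelfOrBelow (basisOf s) x)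
  odd-external⇒¬linIndep s x i x≡2i+1 i∉s indep =
    -1≢0 (trans (sym coeffs[x]≡-1) (indep coeffs coeffs-supported coeffs-combination x))
    where
    S = SelfOrBelow (basisOf s) x

    even∈ : ∀ j → j < n → UsesEven (shareBelow s i j) → ∀ t → toℕ t ≡ 2 * j → S t
    even∈ j j<n uses t t≡2j with j <? i
    ... | yes j<i = inj₂ (chosen-even∈ s j j<n uses t t≡2j ,
                          subst₂ _<_ (sym t≡2j) (sym x≡2i+1) (ℕₚ.m<n⇒m<1+n (2*-mono-< j<i)))
    ... | no _ with j ≟ i
    ...   | yes refl = inj₂ (bit≡true⇒∈ t≡2j (trans (bit-basisOf-even s j j<n) (cong not i∉s)) ,
                             subst₂ _<_ (sym t≡2j) (sym x≡2i+1) (ℕₚ.n<1+n _))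

    odd∈ : ∀ j → j < n → UsesOdd (shareBelow s i j) → ∀ t → toℕ t ≡ suc (2 * j) → S t
    odd∈ j j<n uses t t≡2j+1 with j <? i
    ... | yes j<i = inj₂ (chosen-odd∈ s j j<n uses t t≡2j+1 ,
                          subst₂ _<_ (sym t≡2j+1) (sym x≡2i+1) (s≤s (2*-mono-< j<i)))
    ... | no _ with j ≟ i
    ...   | yes refl = inj₁ (Finₚ.toℕ-injective (trans t≡2j+1 (sym x≡2i+1)))

    balanced : ∀ j → j < n → shareBelow s i j ≡ neither → BackSubstitution.pairTotal n (λ _ → 0ℚ) (shareBelow s i) j ≡ 0ℚ
    balanced j _ ≡neither with j <? i
    ... | yes _ = ⊥-elim (chosenShare≢neither s j ≡neither)
    ... | no j≮i = totalWithin-0 (shareBelow s i) j (n ∸ j) (shareBelow-above s i (suc j) (s≤s (ℕₚ.≮⇒≥ j≮i)))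

    schedule : Schedule n S (λ _ → 0ℚ)
    schedule = record
      { share = shareBelow s i
      ; balanced = balanced
      ; even∈S = even∈
      ; odd∈S = odd∈
      }
    open Schedule schedule

    coeffs[x]≡-1 : coeffs x ≡ negℚ 1ℚ
    coeffs[x]≡-1 = begin
      coeff (toℕ x)                        ≡⟨ cong coeff x≡2i+1 ⟩
      coeff (suc (2 * i))                  ≡⟨ coeff-odd i ⟩
      oddPart (shareBelow s i i) (pairTotal i)
        ≡⟨ cong₂ oddPart (shareBelow-at s i) (totalWithin-0 (shareBelow s i) i (n ∸ i) (shareBelow-above s i (suc i) (ℕₚ.n<1+n i))) ⟩
      oddPart (both 1ℚ) 0ℚ                 ≡⟨⟩
      negℚ 1ℚ                              ∎
      where open ≡-Reasoning

  externallyActive⇐ : ∀ s x → x ∉ basisOf s → LinIndep n (SelfOrBelow (basisOf s) x) → x ∈ externallyActive s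
  externallyActive⇐ s x x∉B indep with parity (toℕ x)
  ... | inj₁ (i , x≡2i) = bit≡true⇒∈ x≡2i (trans (bit-pairSubset-even n (bit s) (λ _ → false) i i<n) i∈s)
    where
    i<n = 2*-cancel-< (subst (_< 2 * n) x≡2i (Finₚ.toℕ<n x))
    i∈s : bit s i ≡ true
    i∈s = not-injective (trans (sym (bit-basisOf-even s i i<n)) (trans (cong (bit (basisOf s)) (sym x≡2i)) (∉⇒bit≡false x∉B)))
      where
      not-injective : ∀ {b} → not b ≡ false → b ≡ true
      not-injective {true} _ = refl
  ... | inj₂ (i , x≡2i+1) = ⊥-elim (odd-external⇒¬linIndep s x i x≡2i+1 i∉s indep)
    where
    i<n = 1+2*-cancel-< (subst (_< 2 * n) x≡2i+1 (Finₚ.toℕ<n x))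
    i∉s : bit s i ≡ false
    i∉s = trans (sym (bit-basisOf-odd s i i<n)) (trans (cong (bit (basisOf s)) (sym x≡2i+1)) (∉⇒bit≡false x∉B))

  val-basisOf : ∀ s → ValIs n (basisOf s) ∣ s ∣
  val-basisOf s = subst (CardIs _) (∣externallyActive∣ s) (CardIs-∈ (externallyActive s) _ λ x →
    mk⇔ (λ (x∉B , indep) → externallyActive⇐ s x x∉B indep) (externallyActive⇒ s x))

  decode : Subset (2 * n) → Subset m
  decode B = fromBits m (λ i → bit B (suc (2 * i)))

  decode-basisOf : ∀ s → decode (basisOf s) ≡ s
  decode-basisOf s = bit-extensionality (decode (basisOf s)) s λ i i<m →
    trans (bit-fromBits m _ i i<m) (bit-basisOf-odd s i (ℕₚ.m<n⇒m<1+n i<m))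

  module _ (B : Subset (2 * n)) (isBasis : IsBasis n B) (internal : Internal n B) where

    private
      indep : LinIndep n (_∈ B)
      indep = proj₁ (proj₂ isBasis)

      active : ∀ b → b ∈ B → ¬ ¬ Spans n (OthersOrAbove B b)
      active = internal⇒internallyActive n B (proj₁ isBasis) internal

    top∉ : bit B (suc (2 * m)) ≡ false
    top∉ with bit B (suc (2 * m)) in eq
    ... | false = refl
    ... | true = ⊥-elim (active top top∈B (¬internallyActive-if-nothing-above n B top indep top∈B nothing-above))
      where
      top<2n : suc (2 * m) < 2 * n
      top<2n = 1+2*-mono-< (ℕₚ.n<1+n m)
      top = fromℕ< top<2n
      top∈B : top ∈ B
      top∈B = bit≡true⇒∈ (Finₚ.toℕ-fromℕ< top<2n) eq
      nothing-above : ∀ t → toℕ top < toℕ t → t ∈ B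
      nothing-above t top<t = ⊥-elim (ℕₚ.<⇒≱ (Finₚ.toℕ<n t)
        (subst (_≤ toℕ t) (trans (cong suc (Finₚ.toℕ-fromℕ< top<2n)) (sym (2*[1+q]≡2+2*q m))) top<t))

    pair-≤1 : ∀ i → i < n → bitℕ (bit B (2 * i)) + bitℕ (bit B (suc (2 * i))) ≤ 1
    pair-≤1 i i<n with bit B (2 * i) in even | bit B (suc (2 * i)) in odd
    ... | false | false = z≤n
    ... | false | true = ℕₚ.≤-refl
    ... | true | false = ℕₚ.≤-refl
    ... | true | true = ⊥-elim (active b b∈B (pair-full⇒¬internallyActive n B i b b′ b≡2i b′≡2i+1 b∈B b′∈B indep))
      where
      b = fromℕ< (2*-mono-< i<n)
      b′ = fromℕ< (1+2*-mono-< i<n)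
      b≡2i = Finₚ.toℕ-fromℕ< (2*-mono-< i<n)
      b′≡2i+1 = Finₚ.toℕ-fromℕ< (1+2*-mono-< i<n)
      b∈B = bit≡true⇒∈ b≡2i even
      b′∈B = bit≡true⇒∈ b′≡2i+1 odd

    -- Each pair holds at most one element of B and ∣B∣ = n, so each holds exactly one.
    pair-≡1 : ∀ i → i < n → bitℕ (bit B (2 * i)) + bitℕ (bit B (suc (2 * i))) ≡ 1
    pair-≡1 = Σℕ≡length⇒all-1 n _ pair-≤1 (begin
      Σℕ n (λ i → bitℕ (bit B (2 * i)) + bitℕ (bit B (suc (2 * i))))  ≡⟨ sym (Σℕ-pairs n (bitℕ ∘ bit B)) ⟩
      Σℕ (2 * n) (bitℕ ∘ bit B)                                        ≡⟨ sym (∣∣≡Σℕ-bit B (2 * n) ℕₚ.≤-refl) ⟩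
      ∣ B ∣                                                            ≡⟨ proj₁ isBasis ⟩
      n                                                                ∎)
      where open ≡-Reasoning

    odd-bit≡decode : ∀ i → i < n → bit B (suc (2 * i)) ≡ bit (decode B) i
    odd-bit≡decode i i<n with i <? m
    ... | yes i<m = sym (bit-fromBits m _ i i<m)
    ... | no i≮m rewrite ℕₚ.≤-antisym (ℕₚ.≤-pred i<n) (ℕₚ.≮⇒≥ i≮m) = trans top∉ (sym (bit-≥ (decode B) m ℕₚ.≤-refl))

    internal⇒basisOf : B ≡ basisOf (decode B)
    internal⇒basisOf = bit-extensionality B (basisOf (decode B)) bits≡
      where
      bits≡ : ∀ k → k < 2 * n → bit B k ≡ bit (basisOf (decode B)) k
      bits≡ k k<2n with parity k
      ... | inj₁ (i , refl) = trans (bitℕ+bitℕ≡1⇒≡not (pair-≡1 i i<n))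
          (trans (cong not (odd-bit≡decode i i<n)) (sym (bit-basisOf-even (decode B) i i<n)))
        where i<n = 2*-cancel-< k<2n
      ... | inj₂ (i , refl) = trans (odd-bit≡decode i i<n) (sym (bit-basisOf-odd (decode B) i i<n))
        where i<n = 1+2*-cancel-< k<2n

  internalBasesOfVal : ℕ → List (Subset (2 * n))
  internalBasesOfVal j = map basisOf (subsetsOfSize m j)

  basisOf-injective : ∀ {s s′} → basisOf s ≡ basisOf s′ → s ≡ s′
  basisOf-injective {s} {s′} eq = trans (sym (decode-basisOf s)) (trans (cong decode eq) (decode-basisOf s′))

  internalBasesOfVal-unique : ∀ j → Unique (internalBasesOfVal j)
  internalBasesOfVal-unique j = Uniqueₚ.map⁺ basisOf-injective (subsetsOfSize-unique m j)

  length-internalBasesOfVal : ∀ j → length (internalBasesOfVal j) ≡ m C j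
  length-internalBasesOfVal j = trans (Listₚ.length-map basisOf (subsetsOfSize m j)) (length-subsetsOfSize m j)

  ∈-internalBasesOfVal : ∀ j B → B Mem.∈ internalBasesOfVal j ⇔ (IsBasis n B × Internal n B × ValIs n B j)
  ∈-internalBasesOfVal j B = mk⇔ to from
    where
    to : B Mem.∈ internalBasesOfVal j → IsBasis n B × Internal n B × ValIs n B j
    to B∈ with Memₚ.∈-map⁻ basisOf B∈
    ... | s , s∈ , refl = isBasis-basisOf s , internal-basisOf s , subst (ValIs n (basisOf s)) (∈-subsetsOfSize⁻ m j s∈) (val-basisOf s)
    from : IsBasis n B × Internal n B × ValIs n B j → B Mem.∈ internalBasesOfVal j
    from (isBasis , internal , val) = subst (Mem._∈ internalBasesOfVal j) (sym B≡)
      (Memₚ.∈-map⁺ basisOf (subst (λ k → decode B Mem.∈ subsetsOfSize m k) ∣decode∣≡j (∈-subsetsOfSize⁺ m (decode B))))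
      where
      B≡ = internal⇒basisOf B isBasis internal
      ∣decode∣≡j = CardIs-unique Finₚ._≟_ (val-basisOf (decode B)) (subst (λ B′ → ValIs n B′ j) B≡ val)

binomRHS≡C : ∀ m j → binomRHS (suc m) j ≡ m C j
binomRHS≡C m j with j <? suc m
... | yes _ = refl
... | no j≮1+m = sym (k>n⇒nCk≡0 (ℕₚ.≮⇒≥ j≮1+m))

theorem3 : (n : ℕ) → 1 ≤ n → (j : ℕ) → HIs n j (binomRHS n j)
theorem3 zero () j
theorem3 (suc m) _ j =
  internalBasesOfVal j , internalBasesOfVal-unique j , ∈-internalBasesOfVal j ,
  trans (length-internalBasesOfVal j) (sym (binomRHS≡C m j))
  where open PairBases m
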